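{- If arbitrary complex weights are allowed, then for $n\ge 6$ even a $p\times q$ rectangle admits a signed tiling by $\mathcal{T}_n^+$ if and only if at least one of $p,q$ is even; and a $p\times q$ rectangle admits a signed tiling by $\mathcal{T}_4^+$ if and only if both $p$ and $q$ are even.
   Context: Identify the unit cell $[a,a+1]\times[b,b+1]$ with $(a,b)\in\mathbb{Z}^2$. For $n$ even, $\mathcal{T}_n$ consists of all integer translates of the polyominoes with cell sets $\{(0,j):0\le j\le n-2\}\cup\{(1,0)\}$, $\{(1,j):0\le j\le n-2\}\cup\{(0,n-2)\}$, $\{(i,0):0\le i\le n-2\}\cup\{(0,1)\}$, $\{(i,1):0\le i\le n-2\}\cup\{(n-2,0)\}$ (translations only); $\mathcal{T}_n^+$ is $\mathcal{T}_n$ together with all translates of the $2\times2$ square. A signed tiling with complex weights of a rectangle $R$ is a finite collection of translated tiles, each with a complex weight, such that the weights of the tiles covering each cell sum to $1$ on cells of $R$ and to $0$ elsewhere. -}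

module Defs where

open import Level using (Level; _⊔_)
open import Algebra.Bundles using (CommutativeRing)
open import Data.Nat as ℕ using (ℕ; zero; suc)
open import Data.Integer as ℤ using (ℤ; +_)
open import Data.Fin as F using (Fin)
open import Data.Bool using (Bool; true; false; _∧_; _∨_; if_then_else_)
open import Data.List using (List; []; _∷_)
open import Data.Product using (_×_; _,_; Σ; ∃)
open import Relation.Nullary using (¬_)
open import Relation.Nullary.Decidable using (⌊_⌋)

-- Algebraically closed fields of characteristic zero
-- (stand-in for ℂ)

module _ {c ℓ} (R : CommutativeRing c ℓ) where
  open CommutativeRing R

  natEmb : ℕ → Carrier
  natEmb zero = 0#
  natEmb (suc m) = 1# + natEmb m

  -- value at x of the monic polynomial a₀ + a₁ x + … + a_{d-1} x^{d-1} + x^d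
  -- given by its lower coefficients [a₀, …, a_{d-1}]
  monicEval : List Carrier → Carrier → Carrier
  monicEval [] x = 1#
  monicEval (a ∷ as) x = a + x * monicEval as x

record ACF0 (c ℓ : Level) : Set (Level.suc (c ⊔ ℓ)) where
  field
    cring : CommutativeRing c ℓ
  open CommutativeRing cring public
  field
    nontrivial : ¬ (1# ≈ 0#)
    inverse : ∀ x → ¬ (x ≈ 0#) → Σ Carrier λ y → x * y ≈ 1#
    charZero : ∀ m → ¬ (natEmb cring (ℕ.suc m) ≈ 0#)
    algClosed : ∀ (a : Carrier) (as : List Carrier) →
                Σ Carrier λ x → monicEval cring (a ∷ as) x ≈ 0#

-- The tile set 𝒯ₙ⁺ (cells are unit squares indexed by ℤ × ℤ, the cell
-- (a,b) being [a,a+1]×[b,b+1]).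
-- Shapes 0..3 are the four polyominoes of 𝒯ₙ, shape 4 is the 2×2 square.

inRange : ℤ → ℤ → Bool
inRange k i = ⌊ + 0 ℤ.≤? i ⌋ ∧ ⌊ i ℤ.≤? k ⌋

is : ℤ → ℤ → Bool
is i k = ⌊ i ℤ.≟ k ⌋

shapeCell : ℕ → Fin 5 → ℤ → ℤ → Bool
shapeCell n F.zero i j =
  (is i (+ 0) ∧ inRange (+ (n ℕ.∸ 2)) j) ∨ (is i (+ 1) ∧ is j (+ 0))
shapeCell n (F.suc F.zero) i j =
  (is i (+ 1) ∧ inRange (+ (n ℕ.∸ 2)) j) ∨ (is i (+ 0) ∧ is j (+ (n ℕ.∸ 2)))
shapeCell n (F.suc (F.suc F.zero)) i j =
  (is j (+ 0) ∧ inRange (+ (n ℕ.∸ 2)) i) ∨ (is i (+ 0) ∧ is j (+ 1))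
shapeCell n (F.suc (F.suc (F.suc F.zero))) i j =
  (is j (+ 1) ∧ inRange (+ (n ℕ.∸ 2)) i) ∨ (is i (+ (n ℕ.∸ 2)) ∧ is j (+ 0))
shapeCell n (F.suc (F.suc (F.suc (F.suc F.zero)))) i j =
  inRange (+ 1) i ∧ inRange (+ 1) j

-- A weighted translated tile of 𝒯ₙ⁺: (shape, translation a, translation b, weight)
WTile : ∀ {c} → Set c → Set c
WTile A = Fin 5 × ℤ × ℤ × A

covers : ℕ → Fin 5 → ℤ → ℤ → ℤ → ℤ → Bool
covers n s a b x y = shapeCell n s (x ℤ.- a) (y ℤ.- b)

inRect : ℕ → ℕ → ℤ → ℤ → Bool
inRect p q x y = inRange (+ p ℤ.- + 1) x ∧ inRange (+ q ℤ.- + 1) y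

module _ {c ℓ} (K : ACF0 c ℓ) where
  open ACF0 K

  weightAt : ℕ → List (WTile Carrier) → ℤ → ℤ → Carrier
  weightAt n [] x y = 0#
  weightAt n ((s , a , b , w) ∷ ts) x y =
    (if covers n s a b x y then w else 0#) + weightAt n ts x y

  IsSignedTiling : ℕ → ℕ → ℕ → List (WTile Carrier) → Set ℓ
  IsSignedTiling n p q ts =
    ∀ (x y : ℤ) → weightAt n ts x y ≈ (if inRect p q x y then 1# else 0#)

  SignedTileable : ℕ → ℕ → ℕ → Set (c ⊔ ℓ)
  SignedTileable n p q = ∃ λ ts → IsSignedTiling n p q ts

module Submission where

-- Sufficiency. The square tile gives every 2 × 2 block, hence every rectangle with both sides even.
-- For even n = M + 2 ≥ 6 the span of 𝒯ₙ⁺ also contains the horizontal domino ε. Two translates of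
-- the first tile minus a column of squares give the row pattern (1, 2, 1); its transposed
-- translates give the column recurrence c(j+2) ≡ -2 c(j+1) - c(j) for single cells, whence
-- c(M) ≡ c(0) - M δ with δ the vertical domino. A difference of two tiles moves the cell c(M) into
-- the bottom row, and together these give 2ε ≡ M δ; with the transposed relation 2δ ≡ M ε this
-- yields (4 - M²) ε ≡ 0, and 4 - M² ≠ 0 in characteristic 0 once M ≥ 4. Dominoes then stack to
-- every rectangle with an even side.
--
-- Necessity. For g : ℤ → K the functional f ↦ Σ g(x + y) f(x, y) vanishes on every tile when
-- g(z) = (-1)ᶻ and M is even, and for n = 4 also when g(z) = (-1)ᶻ z. A signed tiling of a p × q
-- rectangle makes the functional vanish on the rectangle, but the first weight gives 1 on odd × odd
-- rectangles and the second gives -(u + 1) on (2u + 2) × odd ones.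

open import Defs
open import Level using (Level; _⊔_)
open import Data.Nat as ℕ using (ℕ; zero; suc; _≤_; s≤s; z≤n)
import Data.Nat.Properties as ℕP
import Data.Nat.Tactic.RingSolver as ℕSolver
open import Data.Nat.Divisibility using (_∣_; divides)
open import Data.Integer as ℤ using (ℤ; +_; -[1+_]; _⊖_)
import Data.Integer.Properties as ℤP
open import Data.Integer.Tactic.RingSolver as ℤSolver using ()
open import Data.Sign as Sign using (Sign)
open import Data.Bool using (Bool; true; false; _∧_; _∨_; if_then_else_)
open import Data.Bool.Properties using (∧-comm)
open import Data.Fin as F using (Fin)
open import Data.List using (List; []; _∷_; _++_; map)
open import Data.List.Relation.Unary.All as All using (All; []; _∷_)
open import Data.Maybe using (Maybe; just; nothing)
open import Data.Product using (Σ; _×_; _,_; proj₁; proj₂)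
open import Data.Sum using (_⊎_; inj₁; inj₂; [_,_])
open import Data.Empty using (⊥-elim)
open import Function.Base using (_∘_)
open import Function.Bundles using (_⇔_; mk⇔)
open import Relation.Nullary using (Dec; yes; no; ¬_)
open import Relation.Nullary.Decidable using (⌊_⌋; isYes≗does; does-⇔)
open import Relation.Binary.PropositionalEquality as ≡ using (_≡_; _≢_)
open import Algebra.Bundles using (CommutativeRing)
import Algebra.Solver.Ring
import Algebra.Solver.Ring.AlmostCommutativeRing as SolverRing
open import Tactic.RingSolver using (solve-∀)
open import Tactic.RingSolver.Core.AlmostCommutativeRing using (AlmostCommutativeRing; fromCommutativeRing)

x-[a+c]≡x-c-a : ∀ x a c → x ℤ.- (a ℤ.+ c) ≡ (x ℤ.- c) ℤ.- a
x-[a+c]≡x-c-a = ℤSolver.solve-∀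

isYes-⇔ : ∀ {a b} {A : Set a} {B : Set b} → A ⇔ B → (a? : Dec A) (b? : Dec B) → ⌊ a? ⌋ ≡ ⌊ b? ⌋
isYes-⇔ A⇔B a? b? = ≡.trans (isYes≗does a?) (≡.trans (does-⇔ A⇔B a? b?) (≡.sym (isYes≗does b?)))

is-translate : ∀ z a c → is (z ℤ.- a) c ≡ is z (c ℤ.+ a)
is-translate z a c = isYes-⇔ (mk⇔ (λ e → ≡.trans (z≡z-a+a z a) (≡.cong (ℤ._+ a) e))
                           (λ e → ≡.trans (≡.cong (ℤ._- a) e) (c+a-a≡c c a)))
                     (z ℤ.- a ℤ.≟ c) (z ℤ.≟ c ℤ.+ a)
  where
  z≡z-a+a : ∀ z a → z ≡ (z ℤ.- a) ℤ.+ a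
  z≡z-a+a = ℤSolver.solve-∀
  c+a-a≡c : ∀ c a → (c ℤ.+ a) ℤ.- a ≡ c
  c+a-a≡c = ℤSolver.solve-∀

is-disjoint : ∀ z {c d} → c ≢ d → (is z c ∧ is z d) ≡ false
is-disjoint z {c} {d} c≢d with z ℤ.≟ c | z ℤ.≟ d
... | yes ≡.refl | yes z≡d = ⊥-elim (c≢d z≡d)
... | yes _      | no _     = ≡.refl
... | no _       | _        = ≡.refl

inRange-+ : ∀ k m → inRange (+ k) (+ m) ≡ (m ℕ.≤ᵇ k)
inRange-+ k m rewrite isYes≗does (+ 0 ℤ.≤? + m) | isYes≗does (+ m ℤ.≤? + k) = ≡.refl

is-+ : ∀ m c → is (+ m) (+ c) ≡ (m ℕ.≡ᵇ c)
is-+ m c rewrite isYes≗does (+ m ℤ.≟ + c) = ≡.refl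

<ᵇ-suc : ∀ m k → (m ℕ.<ᵇ suc k) ≡ (m ℕ.≤ᵇ k)
<ᵇ-suc zero    k = ≡.refl
<ᵇ-suc (suc m) k = ≡.refl

≤ᵇ-suc : ∀ m k → (m ℕ.≤ᵇ suc k) ≡ ((m ℕ.≤ᵇ k) ∨ (m ℕ.≡ᵇ suc k))
≤ᵇ-suc zero          k       = ≡.refl
≤ᵇ-suc (suc zero)    zero    = ≡.refl
≤ᵇ-suc (suc (suc m)) zero    = ≡.refl
≤ᵇ-suc (suc m)       (suc k) =
  ≡.trans (<ᵇ-suc m (suc k)) (≡.trans (≤ᵇ-suc m k) (≡.cong (_∨ (m ℕ.≡ᵇ suc k)) (≡.sym (<ᵇ-suc m k))))

≤ᵇ-≡ᵇ-suc-disjoint : ∀ m k → ((m ℕ.≤ᵇ k) ∧ (m ℕ.≡ᵇ suc k)) ≡ false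
≤ᵇ-≡ᵇ-suc-disjoint zero          k       = ≡.refl
≤ᵇ-≡ᵇ-suc-disjoint (suc zero)    zero    = ≡.refl
≤ᵇ-≡ᵇ-suc-disjoint (suc (suc m)) zero    = ≡.refl
≤ᵇ-≡ᵇ-suc-disjoint (suc m)       (suc k) =
  ≡.trans (≡.cong (_∧ (m ℕ.≡ᵇ suc k)) (<ᵇ-suc m k)) (≤ᵇ-≡ᵇ-suc-disjoint m k)

≤⇒≤ᵇ≡true : ∀ {j k} → j ℕ.≤ k → (j ℕ.≤ᵇ k) ≡ true
≤⇒≤ᵇ≡true {zero}  _                   = ≡.refl
≤⇒≤ᵇ≡true {suc j} {suc k} (s≤s j≤k) = ≡.trans (<ᵇ-suc j k) (≤⇒≤ᵇ≡true j≤k)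

suc+≤ᵇ≡false : ∀ k e → (suc k ℕ.+ e ℕ.≤ᵇ k) ≡ false
suc+≤ᵇ≡false zero    e = ≡.refl
suc+≤ᵇ≡false (suc k) e = ≡.trans (<ᵇ-suc (suc k ℕ.+ e) k) (suc+≤ᵇ≡false k e)

inRange-suc : ∀ k z → inRange (+ suc k) z ≡ (inRange (+ k) z ∨ is z (+ suc k))
inRange-suc k (+ m) rewrite inRange-+ (suc k) m | inRange-+ k m | is-+ m (suc k) = ≤ᵇ-suc m k
inRange-suc k -[1+ m ] = ≡.refl

inRange-suc-disjoint : ∀ k z → (inRange (+ k) z ∧ is z (+ suc k)) ≡ false
inRange-suc-disjoint k (+ m) rewrite inRange-+ k m | is-+ m (suc k) = ≤ᵇ-≡ᵇ-suc-disjoint m k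
inRange-suc-disjoint k -[1+ m ] = ≡.refl

inRange-zero : ∀ z → inRange (+ 0) z ≡ is z (+ 0)
inRange-zero (+ zero)  = ≡.refl
inRange-zero (+ suc m) = ≡.refl
inRange-zero -[1+ m ]  = ≡.refl

-- (c₁ , k₁ , c₂ , k₂) stands for the block of cells [c₁, c₁ + k₁] × [c₂, c₂ + k₂]; shapeRects M s
-- splits shape s of 𝒯ₙ⁺, n = M + 2, into such blocks.
Rect : Set
Rect = ℕ × ℕ × ℕ × ℕ

shapeRects : ℕ → Fin 5 → List Rect
shapeRects M F.zero                                 = (0 , 0 , 0 , M) ∷ (1 , 0 , 0 , 0) ∷ []
shapeRects M (F.suc F.zero)                         = (1 , 0 , 0 , M) ∷ (0 , 0 , M , 0) ∷ []
shapeRects M (F.suc (F.suc F.zero))                 = (0 , M , 0 , 0) ∷ (0 , 0 , 1 , 0) ∷ []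
shapeRects M (F.suc (F.suc (F.suc F.zero)))         = (0 , M , 1 , 0) ∷ (M , 0 , 0 , 0) ∷ []
shapeRects M (F.suc (F.suc (F.suc (F.suc F.zero)))) = (0 , 1 , 0 , 1) ∷ []

translateRects : ℕ → ℕ → List Rect → List Rect
translateRects c d = map λ { (c₁ , k₁ , c₂ , k₂) → (c₁ ℕ.+ c , k₁ , c₂ ℕ.+ d , k₂) }

module _ {c ℓ} (K : ACF0 c ℓ) where

  open ACF0 K using (cring; nontrivial; inverse; charZero)
  open CommutativeRing cring using (ring; semiring; -‿inverseʳ; -‿inverseˡ; _-_)

  ring⁺ : AlmostCommutativeRing c ℓ
  ring⁺ = fromCommutativeRing cring (λ _ → nothing)

  -- Goals must be stated with ring⁺'s operations for solve-∀ to recognise them.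
  open AlmostCommutativeRing ring⁺ hiding (zero; semiring; -‿+-comm; _-_)
  open import Algebra.Properties.Ring ring using (-‿involutive; -0#≈0#; -‿+-comm; xyx⁻¹≈y; -1*x≈-x; -‿distribˡ-*; -‿injective)
  open import Algebra.Properties.Semiring.Mult.TCOptimised semiring using (×-homo-+; ×1-homo-*; 1+×; ×ᵤ≈×)
    renaming (_×_ to _×′_)
  import Algebra.Properties.Semiring.Mult semiring as Mult
  open import Relation.Binary.Reasoning.Setoid setoid

  ≡⇒≈ : ∀ {x y} → x ≡ y → x ≈ y
  ≡⇒≈ ≡.refl = refl

  -- Unlike natEmb, m ×′ 1# evaluates to 1# and 1# + 1# for m = 1, 2: the ring solver's integer
  -- constants must denote exactly these terms.
  fromℕ : ℕ → Carrier
  fromℕ m = m ×′ 1#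

  fromℕ-+ : ∀ m n → fromℕ (m ℕ.+ n) ≈ fromℕ m + fromℕ n
  fromℕ-+ = ×-homo-+ 1#

  fromℕ-suc : ∀ m → fromℕ (suc m) ≈ 1# + fromℕ m
  fromℕ-suc m = 1+× m 1#

  fromℕ-* : ∀ m n → fromℕ (m ℕ.* n) ≈ fromℕ m * fromℕ n
  fromℕ-* = ×1-homo-*

  ⟨_⟩ : ℕ → Carrier
  ⟨_⟩ = natEmb cring

  ⟨⟩≈fromℕ : ∀ m → ⟨ m ⟩ ≈ fromℕ m
  ⟨⟩≈fromℕ m = trans (≡⇒≈ (natEmb≡×ᵤ m)) (×ᵤ≈× m 1#)
    where
    natEmb≡×ᵤ : ∀ m → ⟨ m ⟩ ≡ m Mult.× 1#
    natEmb≡×ᵤ zero    = ≡.refl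
    natEmb≡×ᵤ (suc m) = ≡.cong (λ x → 1# + x) (natEmb≡×ᵤ m)

  fromℕ-suc≉0 : ∀ m → ¬ fromℕ (suc m) ≈ 0#
  fromℕ-suc≉0 m fromℕ≈0 = charZero m (trans (⟨⟩≈fromℕ (suc m)) fromℕ≈0)

  fromℤ : ℤ → Carrier
  fromℤ (+ m)    = fromℕ m
  fromℤ -[1+ m ] = - fromℕ (suc m)

  +-rearrange : ∀ u v a b → (u + (a + b)) + v ≈ (u + a) + (v + b)
  +-rearrange = solve-∀ ring⁺

  interchange : ∀ a b u v → (a * b) * (u * v) ≈ (a * u) * (b * v)
  interchange = solve-∀ ring⁺

  fromℤ-⊖ : ∀ m n → fromℤ (m ⊖ n) ≈ fromℕ m - fromℕ n
  fromℤ-⊖ zero    zero    = sym (-‿inverseʳ 0#)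
  fromℤ-⊖ zero    (suc n) = sym (+-identityˡ _)
  fromℤ-⊖ (suc m) zero    = sym (trans (+-congˡ -0#≈0#) (+-identityʳ _))
  fromℤ-⊖ (suc m) (suc n) rewrite ℤP.[1+m]⊖[1+n]≡m⊖n m n = begin
    fromℤ (m ⊖ n)                    ≈⟨ fromℤ-⊖ m n ⟩
    fromℕ m - fromℕ n                ≈⟨ xyx⁻¹≈y 1# _ ⟨
    (1# + (fromℕ m - fromℕ n)) - 1#   ≈⟨ +-rearrange 1# (- 1#) (fromℕ m) (- fromℕ n) ⟩
    (1# + fromℕ m) + (- 1# - fromℕ n) ≈⟨ +-cong (fromℕ-suc m) (trans (-‿cong (fromℕ-suc n)) (sym (-‿+-comm 1# (fromℕ n)))) ⟨
    fromℕ (suc m) - fromℕ (suc n)     ∎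

  fromℤ-+ : ∀ i j → fromℤ (i ℤ.+ j) ≈ fromℤ i + fromℤ j
  fromℤ-+ (+ m)    (+ n)    = fromℕ-+ m n
  fromℤ-+ (+ m)    -[1+ n ] = fromℤ-⊖ m (suc n)
  fromℤ-+ -[1+ m ] (+ n)    = trans (fromℤ-⊖ n (suc m)) (+-comm _ _)
  fromℤ-+ -[1+ m ] -[1+ n ] = begin
    - fromℕ (suc (suc (m ℕ.+ n)))          ≡⟨ ≡.cong (λ k → - fromℕ (suc k)) (ℕP.+-suc m n) ⟨
    - fromℕ (suc m ℕ.+ suc n)              ≈⟨ -‿cong (fromℕ-+ (suc m) (suc n)) ⟩
    - (fromℕ (suc m) + fromℕ (suc n))      ≈⟨ -‿+-comm _ _ ⟨
    - fromℕ (suc m) - fromℕ (suc n)        ∎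

  fromℤ-neg : ∀ i → fromℤ (ℤ.- i) ≈ - fromℤ i
  fromℤ-neg (+ zero)  = sym -0#≈0#
  fromℤ-neg (+ suc m) = refl
  fromℤ-neg -[1+ m ]  = sym (-‿involutive _)

  fromSign : Sign → Carrier
  fromSign Sign.+ = 1#
  fromSign Sign.- = - 1#

  fromSign-* : ∀ s t → fromSign (s Sign.* t) ≈ fromSign s * fromSign t
  fromSign-* Sign.+ t      = sym (*-identityˡ _)
  fromSign-* Sign.- Sign.+ = sym (*-identityʳ _)
  fromSign-* Sign.- Sign.- = sym (trans (-1*x≈-x _) (-‿involutive 1#))

  fromℤ-◃ : ∀ s k → fromℤ (s ℤ.◃ k) ≈ fromSign s * fromℕ k
  fromℤ-◃ s      zero    = sym (zeroʳ _)
  fromℤ-◃ Sign.+ (suc k) = sym (*-identityˡ _)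
  fromℤ-◃ Sign.- (suc k) = sym (-1*x≈-x _)

  fromℤ-signAbs : ∀ i → fromℤ i ≈ fromSign (ℤ.sign i) * fromℕ ℤ.∣ i ∣
  fromℤ-signAbs (+ m)    = sym (*-identityˡ _)
  fromℤ-signAbs -[1+ m ] = sym (-1*x≈-x _)

  fromℤ-* : ∀ i j → fromℤ (i ℤ.* j) ≈ fromℤ i * fromℤ j
  fromℤ-* i j = begin
    fromℤ (ℤ.sign i Sign.* ℤ.sign j ℤ.◃ ℤ.∣ i ∣ ℕ.* ℤ.∣ j ∣)
      ≈⟨ fromℤ-◃ (ℤ.sign i Sign.* ℤ.sign j) (ℤ.∣ i ∣ ℕ.* ℤ.∣ j ∣) ⟩
    fromSign (ℤ.sign i Sign.* ℤ.sign j) * fromℕ (ℤ.∣ i ∣ ℕ.* ℤ.∣ j ∣)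
      ≈⟨ *-cong (fromSign-* (ℤ.sign i) (ℤ.sign j)) (fromℕ-* ℤ.∣ i ∣ ℤ.∣ j ∣) ⟩
    (fromSign (ℤ.sign i) * fromSign (ℤ.sign j)) * (fromℕ ℤ.∣ i ∣ * fromℕ ℤ.∣ j ∣)
      ≈⟨ interchange _ _ _ _ ⟩
    (fromSign (ℤ.sign i) * fromℕ ℤ.∣ i ∣) * (fromSign (ℤ.sign j) * fromℕ ℤ.∣ j ∣)
      ≈⟨ *-cong (fromℤ-signAbs i) (fromℤ-signAbs j) ⟨
    fromℤ i * fromℤ j                                              ∎

  fromℤ-homomorphism : ℤ.+-*-rawRing SolverRing.-Raw-AlmostCommutative⟶ SolverRing.fromCommutativeRing cring
  fromℤ-homomorphism = record
    { ⟦_⟧    = fromℤ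
    ; +-homo = fromℤ-+
    ; *-homo = fromℤ-*
    ; -‿homo = fromℤ-neg
    ; 0-homo = refl
    ; 1-homo = refl
    }

  fromℤ-≟ : ∀ i j → Maybe (fromℤ i ≈ fromℤ j)
  fromℤ-≟ i j with i ℤ.≟ j
  ... | yes ≡.refl = just refl
  ... | no _       = nothing

  open Algebra.Solver.Ring ℤ.+-*-rawRing (SolverRing.fromCommutativeRing cring) fromℤ-homomorphism fromℤ-≟
    using (solve; _:=_; _:+_; _:*_; :-_; _:-_; con; Polynomial)

  -- As in IsSignedTiling, so that SignedTileable K n p q is InSpan n (λ x y → ⟦ inRect p q x y ⟧).
  ⟦_⟧ : Bool → Carrier
  ⟦ b ⟧ = if b then 1# else 0#

  ⟦∧⟧ : ∀ a b → ⟦ a ∧ b ⟧ ≈ ⟦ a ⟧ * ⟦ b ⟧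
  ⟦∧⟧ true  b = sym (*-identityˡ _)
  ⟦∧⟧ false b = sym (zeroˡ _)

  ⟦∨⟧-disjoint : ∀ a b → ⟦ a ⟧ * ⟦ b ⟧ ≈ 0# → ⟦ a ∨ b ⟧ ≈ ⟦ a ⟧ + ⟦ b ⟧
  ⟦∨⟧-disjoint true  true  1*1≈0 = trans 1≈0 (sym (trans (+-cong 1≈0 1≈0) (+-identityˡ 0#)))
    where
    1≈0 : 1# ≈ 0#
    1≈0 = trans (sym (*-identityˡ 1#)) 1*1≈0
  ⟦∨⟧-disjoint true  false _ = sym (+-identityʳ 1#)
  ⟦∨⟧-disjoint false b     _ = sym (+-identityˡ _)

  if-then-0 : ∀ b w → (if b then w else 0#) ≈ ⟦ b ⟧ * w
  if-then-0 true  w = sym (*-identityˡ w)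
  if-then-0 false w = sym (zeroˡ w)

  ⟦≡⟧ : ∀ {a b} → a ≡ b → ⟦ a ⟧ ≈ ⟦ b ⟧
  ⟦≡⟧ ≡.refl = refl

  interval : ℕ → ℤ → Carrier
  interval k z = ⟦ inRange (+ k) z ⟧

  block : ℕ → ℕ → ℤ → Carrier
  block c k z = interval k (z ℤ.- + c)

  inRange≈block : ∀ k z → ⟦ inRange (+ k) z ⟧ ≈ block 0 k z
  inRange≈block k z = ⟦≡⟧ (≡.cong (inRange (+ k)) (≡.sym (ℤP.+-identityʳ z)))

  rectangle-indicator : ∀ p q x y → ⟦ inRect (suc p) (suc q) x y ⟧ ≈ block 0 p x * block 0 q y
  rectangle-indicator p q x y =
    trans (⟦∧⟧ (inRange (+ p) x) (inRange (+ q) y)) (*-cong (inRange≈block p x) (inRange≈block q y))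

  is≈block : ∀ c z → ⟦ is z (+ c) ⟧ ≈ block c 0 z
  is≈block c z = ⟦≡⟧ (≡.sym (≡.trans (inRange-zero (z ℤ.- + c)) (is-translate z (+ c) (+ 0))))

  block-translate : ∀ c k d z → block c k (z ℤ.- + d) ≈ block (c ℕ.+ d) k z
  block-translate c k d z = ⟦≡⟧ (≡.cong (inRange (+ k)) (≡.sym (x-[a+c]≡x-c-a z (+ c) (+ d))))

  block-suc : ∀ c k z → block c (suc k) z ≈ block c k z + block (c ℕ.+ suc k) 0 z
  block-suc c k z = begin
    ⟦ inRange (+ suc k) w ⟧                 ≡⟨ ≡.cong ⟦_⟧ (inRange-suc k w) ⟩
    ⟦ inRange (+ k) w ∨ is w (+ suc k) ⟧     ≈⟨ ⟦∨⟧-disjoint _ _ disjoint ⟩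
    block c k z + ⟦ is w (+ suc k) ⟧         ≡⟨ ≡.cong (λ b → block c k z + ⟦ b ⟧) (is-translate z (+ c) (+ suc k)) ⟩
    block c k z + ⟦ is z (+ (suc k ℕ.+ c)) ⟧  ≡⟨ ≡.cong (λ m → block c k z + ⟦ is z (+ m) ⟧) (ℕP.+-comm (suc k) c) ⟩
    block c k z + ⟦ is z (+ (c ℕ.+ suc k)) ⟧  ≈⟨ +-congˡ (is≈block (c ℕ.+ suc k) z) ⟩
    block c k z + block (c ℕ.+ suc k) 0 z    ∎
    where
    w : ℤ
    w = z ℤ.- + c
    disjoint : ⟦ inRange (+ k) w ⟧ * ⟦ is w (+ suc k) ⟧ ≈ 0#
    disjoint = trans (sym (⟦∧⟧ (inRange (+ k) w) (is w (+ suc k)))) (⟦≡⟧ (inRange-suc-disjoint k w))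

  block-append : ∀ c k l z → block c (k ℕ.+ suc l) z ≈ block c k z + block (c ℕ.+ suc k) l z
  block-append c k zero z = begin
    block c (k ℕ.+ 1) z                       ≡⟨ ≡.cong (λ m → block c m z) (ℕP.+-comm k 1) ⟩
    block c (suc k) z                          ≈⟨ block-suc c k z ⟩
    block c k z + block (c ℕ.+ suc k) 0 z       ∎
  block-append c k (suc l) z = begin
    block c (k ℕ.+ suc (suc l)) z
      ≡⟨ ≡.cong (λ m → block c m z) (ℕP.+-suc k (suc l)) ⟩
    block c (suc (k ℕ.+ suc l)) z
      ≈⟨ block-suc c (k ℕ.+ suc l) z ⟩
    block c (k ℕ.+ suc l) z + block (c ℕ.+ suc (k ℕ.+ suc l)) 0 z
      ≈⟨ +-cong (block-append c k l z)
                (⟦≡⟧ (≡.cong (λ m → inRange (+ 0) (z ℤ.- + m)) (≡.sym (ℕP.+-assoc c (suc k) (suc l))))) ⟩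
    (block c k z + block (c ℕ.+ suc k) l z) + block (c ℕ.+ suc k ℕ.+ suc l) 0 z
      ≈⟨ +-assoc _ _ _ ⟩
    block c k z + (block (c ℕ.+ suc k) l z + block (c ℕ.+ suc k ℕ.+ suc l) 0 z)
      ≈⟨ +-congˡ (block-suc (c ℕ.+ suc k) l z) ⟨
    block c k z + block (c ℕ.+ suc k) (suc l) z
      ∎

  Tiles : Set c
  Tiles = List (WTile Carrier)

  weightAt-++ : ∀ n ts us x y → weightAt K n (ts ++ us) x y ≈ weightAt K n ts x y + weightAt K n us x y
  weightAt-++ n []                  us x y = sym (+-identityˡ _)
  weightAt-++ n ((s , a , b , w) ∷ ts) us x y = trans (+-congˡ (weightAt-++ n ts us x y)) (sym (+-assoc _ _ _))

  scaleTiles : Carrier → Tiles → Tiles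
  scaleTiles k = map λ { (s , a , b , w) → (s , a , b , k * w) }

  weightAt-scale : ∀ n k ts x y → weightAt K n (scaleTiles k ts) x y ≈ k * weightAt K n ts x y
  weightAt-scale n k []                  x y = sym (zeroʳ k)
  weightAt-scale n k ((s , a , b , w) ∷ ts) x y = begin
    (if t then k * w else 0#) + weightAt K n (scaleTiles k ts) x y  ≈⟨ +-cong (if-then-0 t (k * w)) (weightAt-scale n k ts x y) ⟩
    ⟦ t ⟧ * (k * w) + k * weightAt K n ts x y                       ≈⟨ +-congʳ (x*[y*z]≈y*[x*z] ⟦ t ⟧ k w) ⟩
    k * (⟦ t ⟧ * w) + k * weightAt K n ts x y                       ≈⟨ distribˡ k _ _ ⟨
    k * (⟦ t ⟧ * w + weightAt K n ts x y)                          ≈⟨ *-congˡ (+-congʳ (if-then-0 t w)) ⟨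
    k * ((if t then w else 0#) + weightAt K n ts x y)               ∎
    where
    t : Bool
    t = covers n s a b x y
    x*[y*z]≈y*[x*z] : ∀ u k w → u * (k * w) ≈ k * (u * w)
    x*[y*z]≈y*[x*z] = solve-∀ ring⁺

  translateTiles : ℤ → ℤ → Tiles → Tiles
  translateTiles c d = map λ { (s , a , b , w) → (s , a ℤ.+ c , b ℤ.+ d , w) }

  weightAt-translate : ∀ n c d ts x y → weightAt K n (translateTiles c d ts) x y ≈ weightAt K n ts (x ℤ.- c) (y ℤ.- d)
  weightAt-translate n c d []                  x y = refl
  weightAt-translate n c d ((s , a , b , w) ∷ ts) x y
    rewrite ≡.cong₂ (shapeCell n s) (x-[a+c]≡x-c-a x a c) (x-[a+c]≡x-c-a y b d) = +-congˡ (weightAt-translate n c d ts x y)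

  transposeShape : Fin 5 → Fin 5
  transposeShape F.zero                               = F.suc (F.suc F.zero)
  transposeShape (F.suc F.zero)                       = F.suc (F.suc (F.suc F.zero))
  transposeShape (F.suc (F.suc F.zero))               = F.zero
  transposeShape (F.suc (F.suc (F.suc F.zero)))       = F.suc F.zero
  transposeShape (F.suc (F.suc (F.suc (F.suc F.zero)))) = F.suc (F.suc (F.suc (F.suc F.zero)))

  shapeCell-transpose : ∀ n s i j → shapeCell n (transposeShape s) j i ≡ shapeCell n s i j
  shapeCell-transpose n F.zero i j =
    ≡.cong ((is i (+ 0) ∧ inRange (+ (n ℕ.∸ 2)) j) ∨_) (∧-comm (is j (+ 0)) (is i (+ 1)))
  shapeCell-transpose n (F.suc F.zero) i j =
    ≡.cong ((is i (+ 1) ∧ inRange (+ (n ℕ.∸ 2)) j) ∨_) (∧-comm (is j (+ (n ℕ.∸ 2))) (is i (+ 0)))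
  shapeCell-transpose n (F.suc (F.suc F.zero)) i j =
    ≡.cong ((is j (+ 0) ∧ inRange (+ (n ℕ.∸ 2)) i) ∨_) (∧-comm (is j (+ 1)) (is i (+ 0)))
  shapeCell-transpose n (F.suc (F.suc (F.suc F.zero))) i j =
    ≡.cong ((is j (+ 1) ∧ inRange (+ (n ℕ.∸ 2)) i) ∨_) (∧-comm (is j (+ 0)) (is i (+ (n ℕ.∸ 2))))
  shapeCell-transpose n (F.suc (F.suc (F.suc (F.suc F.zero)))) i j = ∧-comm (inRange (+ 1) j) (inRange (+ 1) i)

  transposeTiles : Tiles → Tiles
  transposeTiles = map λ { (s , a , b , w) → (transposeShape s , b , a , w) }

  weightAt-transpose : ∀ n ts x y → weightAt K n (transposeTiles ts) y x ≈ weightAt K n ts x y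
  weightAt-transpose n []                  x y = refl
  weightAt-transpose n ((s , a , b , w) ∷ ts) x y
    rewrite shapeCell-transpose n s (x ℤ.- a) (y ℤ.- b) = +-congˡ (weightAt-transpose n ts x y)

  InSpan : ℕ → (ℤ → ℤ → Carrier) → Set (c ⊔ ℓ)
  InSpan n f = Σ Tiles λ ts → ∀ x y → weightAt K n ts x y ≈ f x y

  InSpan-resp : ∀ {n f g} → (∀ x y → f x y ≈ g x y) → InSpan n f → InSpan n g
  InSpan-resp f≈g (ts , ts≈f) = ts , λ x y → trans (ts≈f x y) (f≈g x y)

  InSpan-0 : ∀ {n} → InSpan n (λ _ _ → 0#)
  InSpan-0 = [] , λ _ _ → refl

  InSpan-+ : ∀ {n f g} → InSpan n f → InSpan n g → InSpan n (λ x y → f x y + g x y)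
  InSpan-+ {n} (ts , ts≈f) (us , us≈g) = ts ++ us , λ x y → trans (weightAt-++ n ts us x y) (+-cong (ts≈f x y) (us≈g x y))

  InSpan-* : ∀ {n f} k → InSpan n f → InSpan n (λ x y → k * f x y)
  InSpan-* {n} k (ts , ts≈f) = scaleTiles k ts , λ x y → trans (weightAt-scale n k ts x y) (*-congˡ (ts≈f x y))

  InSpan-translate : ∀ {n f} c d → InSpan n f → InSpan n (λ x y → f (x ℤ.- c) (y ℤ.- d))
  InSpan-translate {n} c d (ts , ts≈f) = translateTiles c d ts , λ x y → trans (weightAt-translate n c d ts x y) (ts≈f _ _)

  InSpan-transpose : ∀ {n f} → InSpan n f → InSpan n (λ x y → f y x)
  InSpan-transpose {n} (ts , ts≈f) = transposeTiles ts , λ x y → trans (weightAt-transpose n ts y x) (ts≈f y x)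

  InSpan-tile : ∀ n s a b → InSpan n (λ x y → ⟦ covers n s a b x y ⟧)
  InSpan-tile n s a b = (s , a , b , 1#) ∷ [] , λ x y →
    trans (+-identityʳ _) (trans (if-then-0 (covers n s a b x y) 1#) (*-identityʳ _))

  rectIndicator : Rect → ℤ → ℤ → Carrier
  rectIndicator (c₁ , k₁ , c₂ , k₂) x y = block c₁ k₁ x * block c₂ k₂ y

  rectsIndicator : List Rect → ℤ → ℤ → Carrier
  rectsIndicator []       x y = 0#
  rectsIndicator (r ∷ rs) x y = rectIndicator r x y + rectsIndicator rs x y

  rectsIndicator-translate : ∀ c d rs x y →
    rectsIndicator rs (x ℤ.- + c) (y ℤ.- + d) ≈ rectsIndicator (translateRects c d rs) x y
  rectsIndicator-translate c d []                      x y = refl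
  rectsIndicator-translate c d ((c₁ , k₁ , c₂ , k₂) ∷ rs) x y =
    +-cong (*-cong (block-translate c₁ k₁ c x) (block-translate c₂ k₂ d y)) (rectsIndicator-translate c d rs x y)

  ⟦is⟧-disjoint : ∀ z {c d} → c ≢ d → ⟦ is z c ⟧ * ⟦ is z d ⟧ ≈ 0#
  ⟦is⟧-disjoint z {c} {d} c≢d = trans (sym (⟦∧⟧ (is z c) (is z d))) (⟦≡⟧ (is-disjoint z c≢d))

  disjoint₁₃ : ∀ {a b u v} → a * u ≈ 0# → (a * b) * (u * v) ≈ 0#
  disjoint₁₃ {a} {b} {u} {v} au≈0 = trans (interchange a b u v) (trans (*-congʳ au≈0) (zeroˡ _))

  disjoint₁₄ : ∀ {a b u v} → a * v ≈ 0# → (a * b) * (u * v) ≈ 0#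
  disjoint₁₄ {a} {b} {u} {v} av≈0 =
    trans (*-congˡ (*-comm u v)) (trans (interchange a b v u) (trans (*-congʳ av≈0) (zeroˡ _)))

  padded : ∀ {a b} → a ≈ b → a ≈ b + 0#
  padded a≈b = trans a≈b (sym (+-identityʳ _))

  ⟦∧∨∧⟧ : ∀ p q r s → (⟦ p ⟧ * ⟦ q ⟧) * (⟦ r ⟧ * ⟦ s ⟧) ≈ 0# →
    ⟦ (p ∧ q) ∨ (r ∧ s) ⟧ ≈ ⟦ p ⟧ * ⟦ q ⟧ + ⟦ r ⟧ * ⟦ s ⟧
  ⟦∧∨∧⟧ p q r s disjoint = begin
    ⟦ (p ∧ q) ∨ (r ∧ s) ⟧   ≈⟨ ⟦∨⟧-disjoint (p ∧ q) (r ∧ s) (trans (*-cong (⟦∧⟧ p q) (⟦∧⟧ r s)) disjoint) ⟩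
    ⟦ p ∧ q ⟧ + ⟦ r ∧ s ⟧   ≈⟨ +-cong (⟦∧⟧ p q) (⟦∧⟧ r s) ⟩
    ⟦ p ⟧ * ⟦ q ⟧ + ⟦ r ⟧ * ⟦ s ⟧ ∎

  shapeCell-rects : ∀ n s i j → ⟦ shapeCell n s i j ⟧ ≈ rectsIndicator (shapeRects (n ℕ.∸ 2) s) i j
  shapeCell-rects n F.zero i j =
    trans (⟦∧∨∧⟧ _ _ _ _ (disjoint₁₃ (⟦is⟧-disjoint i λ ())))
          (+-cong (*-cong (is≈block 0 i) (inRange≈block (n ℕ.∸ 2) j))
                  (padded (*-cong (is≈block 1 i) (is≈block 0 j))))
  shapeCell-rects n (F.suc F.zero) i j =
    trans (⟦∧∨∧⟧ _ _ _ _ (disjoint₁₃ (⟦is⟧-disjoint i λ ())))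
          (+-cong (*-cong (is≈block 1 i) (inRange≈block (n ℕ.∸ 2) j))
                  (padded (*-cong (is≈block 0 i) (is≈block (n ℕ.∸ 2) j))))
  shapeCell-rects n (F.suc (F.suc F.zero)) i j =
    trans (⟦∧∨∧⟧ _ _ _ _ (disjoint₁₄ (⟦is⟧-disjoint j λ ())))
          (+-cong (trans (*-comm _ _) (*-cong (inRange≈block (n ℕ.∸ 2) i) (is≈block 0 j)))
                  (padded (*-cong (is≈block 0 i) (is≈block 1 j))))
  shapeCell-rects n (F.suc (F.suc (F.suc F.zero))) i j =
    trans (⟦∧∨∧⟧ _ _ _ _ (disjoint₁₄ (⟦is⟧-disjoint j λ ())))
          (+-cong (trans (*-comm _ _) (*-cong (inRange≈block (n ℕ.∸ 2) i) (is≈block 1 j)))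
                  (padded (*-cong (is≈block (n ℕ.∸ 2) i) (is≈block 0 j))))
  shapeCell-rects n (F.suc (F.suc (F.suc (F.suc F.zero)))) i j =
    padded (trans (⟦∧⟧ (inRange (+ 1) i) (inRange (+ 1) j)) (*-cong (inRange≈block 1 i) (inRange≈block 1 j)))

  InSpan-shape : ∀ n s → InSpan n (rectsIndicator (shapeRects (n ℕ.∸ 2) s))
  InSpan-shape n s = InSpan-resp (λ x y → trans (⟦≡⟧ (≡.cong₂ (shapeCell n s) (ℤP.+-identityʳ x) (ℤP.+-identityʳ y)))
                                               (shapeCell-rects n s x y))
                                 (InSpan-tile n s (+ 0) (+ 0))

  InSpan-shape-at : ∀ n s c d → InSpan n (rectsIndicator (translateRects c d (shapeRects (n ℕ.∸ 2) s)))
  InSpan-shape-at n s c d = InSpan-resp (rectsIndicator-translate c d (shapeRects (n ℕ.∸ 2) s)) (InSpan-translate (+ c) (+ d) (InSpan-shape n s))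

  -- Sufficiency

  stack-y : ∀ {n} (F : ℤ → Carrier) k → InSpan n (λ x y → F x * block 0 k y) →
            ∀ i → InSpan n (λ x y → F x * block 0 (i ℕ.* suc k ℕ.+ k) y)
  stack-y F k base zero    = base
  stack-y F k base (suc i) = InSpan-resp append (InSpan-+ base (InSpan-translate (+ 0) (+ suc k) (stack-y F k base i)))
    where
    l : ℕ
    l = i ℕ.* suc k ℕ.+ k
    append : ∀ x y → F x * block 0 k y + F (x ℤ.- + 0) * block 0 l (y ℤ.- + suc k) ≈ F x * block 0 (suc i ℕ.* suc k ℕ.+ k) y
    append x y = begin
      F x * block 0 k y + F (x ℤ.- + 0) * block 0 l (y ℤ.- + suc k)
        ≈⟨ +-congˡ (*-cong (≡⇒≈ (≡.cong F (ℤP.+-identityʳ x))) (block-translate 0 l (suc k) y)) ⟩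
      F x * block 0 k y + F x * block (suc k) l y       ≈⟨ distribˡ (F x) _ _ ⟨
      F x * (block 0 k y + block (suc k) l y)           ≈⟨ *-congˡ (block-append 0 k l y) ⟨
      F x * block 0 (k ℕ.+ suc l) y                     ≡⟨ ≡.cong (λ m → F x * block 0 m y) (length i k) ⟩
      F x * block 0 (suc i ℕ.* suc k ℕ.+ k) y           ∎
      where
      length : ∀ i k → k ℕ.+ suc (i ℕ.* suc k ℕ.+ k) ≡ suc i ℕ.* suc k ℕ.+ k
      length = ℕSolver.solve-∀

  InSpan-square : ∀ n → InSpan n (λ x y → block 0 1 x * block 0 1 y)
  InSpan-square n = InSpan-resp (λ x y → +-identityʳ _) (InSpan-shape n (F.suc (F.suc (F.suc (F.suc F.zero)))))

  block-odd : ∀ c u z → block c (u ℕ.* 2 ℕ.+ 1) z ≈ block c (suc (u ℕ.* 2)) z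
  block-odd c u z = ⟦≡⟧ (≡.cong (λ m → inRange (+ m) (z ℤ.- + c)) (ℕP.+-comm (u ℕ.* 2) 1))

  cell : ℕ → ℤ → Carrier
  cell a z = block a 0 z

  module DominoConstruction (i : ℕ) where

    M n : ℕ
    M = suc i ℕ.* 2
    n = suc (suc M)

    arm : ℤ → Carrier
    arm y = block 1 (suc (i ℕ.* 2)) y

    δ ε : ℤ → ℤ → Carrier
    ε x y = cell 0 x * cell 0 y + cell 1 x * cell 0 y
    δ x y = cell 0 x * cell 0 y + cell 0 x * cell 1 y

    shape₀ : InSpan n (λ x y → cell 0 x * (cell 0 y + arm y) + cell 1 x * cell 0 y)
    shape₀ = InSpan-resp (λ x y → +-cong (*-congˡ (block-append 0 0 (suc (i ℕ.* 2)) y)) (+-identityʳ _)) (InSpan-shape n F.zero)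

    shape₀′ : InSpan n (λ x y → cell 1 x * (cell 0 y + arm y) + cell 2 x * cell 0 y)
    shape₀′ = InSpan-resp (λ x y → +-cong (*-congˡ (block-append 0 0 (suc (i ℕ.* 2)) y)) (+-identityʳ _)) (InSpan-shape-at n F.zero 1 0)

    shape₁ : InSpan n (λ x y → cell 1 x * (cell 0 y + arm y) + cell 0 x * cell M y)
    shape₁ = InSpan-resp (λ x y → +-cong (*-congˡ (block-append 0 0 (suc (i ℕ.* 2)) y)) (+-identityʳ _)) (InSpan-shape n (F.suc F.zero))

    armColumn : InSpan n (λ x y → (cell 0 x + cell 1 x) * arm y)
    armColumn = InSpan-resp shift (InSpan-translate (+ 0) (+ 1) (stack-y (block 0 1) 1 (InSpan-square n) i))
      where
      shift : ∀ x y → block 0 1 (x ℤ.- + 0) * block 0 (i ℕ.* 2 ℕ.+ 1) (y ℤ.- + 1) ≈ (cell 0 x + cell 1 x) * arm y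
      shift x y = *-cong (trans (block-translate 0 1 0 x) (block-suc 0 0 x))
                         (trans (block-translate 0 (i ℕ.* 2 ℕ.+ 1) 1 y) (block-odd 1 i y))

    rowTriple : InSpan n (λ x y → (cell 0 x + (cell 1 x + cell 1 x) + cell 2 x) * cell 0 y)
    rowTriple = InSpan-resp (λ x y → identity (cell 0 x) (cell 1 x) (cell 2 x) (cell 0 y) (arm y))
                            (InSpan-+ (InSpan-+ shape₀ shape₀′) (InSpan-* (- 1#) armColumn))
      where
      identity : ∀ p₀ p₁ p₂ q₀ a →
        (p₀ * (q₀ + a) + p₁ * q₀) + (p₁ * (q₀ + a) + p₂ * q₀) + - 1# * ((p₀ + p₁) * a) ≈ (p₀ + (p₁ + p₁) + p₂) * q₀
      identity = solve 5 (λ p₀ p₁ p₂ q₀ a →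
        (p₀ :* (q₀ :+ a) :+ p₁ :* q₀) :+ (p₁ :* (q₀ :+ a) :+ p₂ :* q₀) :+ con (ℤ.- + 1) :* ((p₀ :+ p₁) :* a)
        := (p₀ :+ (p₁ :+ p₁) :+ p₂) :* q₀) refl

    cornerDifference : InSpan n (λ x y → cell 2 x * cell 0 y + - (cell 0 x * cell M y))
    cornerDifference = InSpan-resp (λ x y → identity (cell 0 x) (cell 1 x) (cell 2 x) (cell 0 y) (arm y) (cell M y))
                                   (InSpan-+ shape₀′ (InSpan-* (- 1#) shape₁))
      where
      identity : ∀ p₀ p₁ p₂ q₀ a qₘ →
        (p₁ * (q₀ + a) + p₂ * q₀) + - 1# * (p₁ * (q₀ + a) + p₀ * qₘ) ≈ p₂ * q₀ + - (p₀ * qₘ)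
      identity = solve 6 (λ p₀ p₁ p₂ q₀ a qₘ →
        (p₁ :* (q₀ :+ a) :+ p₂ :* q₀) :+ con (ℤ.- + 1) :* (p₁ :* (q₀ :+ a) :+ p₀ :* qₘ) := p₂ :* q₀ :- p₀ :* qₘ) refl

    columnTriple : ∀ j → InSpan n (λ x y → (cell j y + (cell (suc j) y + cell (suc j) y) + cell (suc (suc j)) y) * cell 0 x)
    columnTriple j = InSpan-resp shift (InSpan-translate (+ 0) (+ j) (InSpan-transpose rowTriple))
      where
      shift : ∀ x y → (cell 0 (y ℤ.- + j) + (cell 1 (y ℤ.- + j) + cell 1 (y ℤ.- + j)) + cell 2 (y ℤ.- + j)) * cell 0 (x ℤ.- + 0)
                    ≈ (cell j y + (cell (suc j) y + cell (suc j) y) + cell (suc (suc j)) y) * cell 0 x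
      shift x y = *-cong (+-cong (+-cong (block-translate 0 0 j y)
                                         (+-cong (block-translate 1 0 j y) (block-translate 1 0 j y)))
                                 (block-translate 2 0 j y))
                         (block-translate 0 0 0 x)

    -- Modulo the span, cell 0 x * cell j y ≡ (-1)ʲ (cell 0 x * cell 0 y - j δ x y).
    evenCellRelation oddCellRelation : ℕ → ℤ → ℤ → Carrier
    evenCellRelation j x y = cell 0 x * cell (j ℕ.* 2) y + - (cell 0 x * cell 0 y) + ⟨ j ℕ.* 2 ⟩ * δ x y
    oddCellRelation  j x y = cell 0 x * cell (suc (j ℕ.* 2)) y + cell 0 x * cell 0 y + - (⟨ suc (j ℕ.* 2) ⟩ * δ x y)

    cellRelations : ∀ j → InSpan n (evenCellRelation j) × InSpan n (oddCellRelation j)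
    cellRelations zero =
        InSpan-resp (λ x y → even₀ (cell 0 x) (cell 0 y) (cell 1 y)) InSpan-0
      , InSpan-resp (λ x y → odd₀ (cell 0 x) (cell 0 y) (cell 1 y)) InSpan-0
      where
      even₀ : ∀ p q₀ q₁ → 0# ≈ p * q₀ + - (p * q₀) + 0# * (p * q₀ + p * q₁)
      even₀ = solve 3 (λ p q₀ q₁ → con (+ 0) := p :* q₀ :- p :* q₀ :+ con (+ 0) :* (p :* q₀ :+ p :* q₁)) refl
      odd₀ : ∀ p q₀ q₁ → 0# ≈ p * q₁ + p * q₀ + - ((1# + 0#) * (p * q₀ + p * q₁))
      odd₀ = solve 3 (λ p q₀ q₁ → con (+ 0) := p :* q₁ :+ p :* q₀ :- (con (+ 1) :+ con (+ 0)) :* (p :* q₀ :+ p :* q₁)) refl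
    cellRelations (suc j) = even′ , odd′
      where
      even : InSpan n (evenCellRelation j)
      even = proj₁ (cellRelations j)
      odd : InSpan n (oddCellRelation j)
      odd = proj₂ (cellRelations j)
      even′ : InSpan n (evenCellRelation (suc j))
      even′ = InSpan-resp (λ x y → step (cell 0 x) (cell 0 y) (cell 1 y) (cell (j ℕ.* 2) y) (cell (suc (j ℕ.* 2)) y)
                                        (cell (suc j ℕ.* 2) y) ⟨ j ℕ.* 2 ⟩)
                          (InSpan-+ (InSpan-+ (columnTriple (j ℕ.* 2)) (InSpan-* (- 1#) even)) (InSpan-* (- (1# + 1#)) odd))
        where
        step : ∀ p q₀ q₁ a b c v →
          (a + (b + b) + c) * p + - 1# * (p * a + - (p * q₀) + v * (p * q₀ + p * q₁))
            + - (1# + 1#) * (p * b + p * q₀ + - ((1# + v) * (p * q₀ + p * q₁)))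
          ≈ p * c + - (p * q₀) + (1# + (1# + v)) * (p * q₀ + p * q₁)
        step = solve 7 (λ p q₀ q₁ a b c v →
          (a :+ (b :+ b) :+ c) :* p :+ con (ℤ.- + 1) :* (p :* a :- p :* q₀ :+ v :* (p :* q₀ :+ p :* q₁))
            :+ (:- con (+ 2)) :* (p :* b :+ p :* q₀ :- (con (+ 1) :+ v) :* (p :* q₀ :+ p :* q₁))
          := p :* c :- p :* q₀ :+ (con (+ 1) :+ (con (+ 1) :+ v)) :* (p :* q₀ :+ p :* q₁)) refl
      odd′ : InSpan n (oddCellRelation (suc j))
      odd′ = InSpan-resp (λ x y → step (cell 0 x) (cell 0 y) (cell 1 y) (cell (suc (j ℕ.* 2)) y) (cell (suc j ℕ.* 2) y)
                                       (cell (suc (suc j ℕ.* 2)) y) ⟨ j ℕ.* 2 ⟩)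
                         (InSpan-+ (InSpan-+ (columnTriple (suc (j ℕ.* 2))) (InSpan-* (- 1#) odd)) (InSpan-* (- (1# + 1#)) even′))
        where
        step : ∀ p q₀ q₁ b c d v →
          (b + (c + c) + d) * p + - 1# * (p * b + p * q₀ + - ((1# + v) * (p * q₀ + p * q₁)))
            + - (1# + 1#) * (p * c + - (p * q₀) + (1# + (1# + v)) * (p * q₀ + p * q₁))
          ≈ p * d + p * q₀ + - ((1# + (1# + (1# + v))) * (p * q₀ + p * q₁))
        step = solve 7 (λ p q₀ q₁ b c d v →
          (b :+ (c :+ c) :+ d) :* p :+ con (ℤ.- + 1) :* (p :* b :+ p :* q₀ :- (con (+ 1) :+ v) :* (p :* q₀ :+ p :* q₁))
            :+ (:- con (+ 2)) :* (p :* c :- p :* q₀ :+ (con (+ 1) :+ (con (+ 1) :+ v)) :* (p :* q₀ :+ p :* q₁))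
          := p :* d :+ p :* q₀ :- (con (+ 1) :+ (con (+ 1) :+ (con (+ 1) :+ v))) :* (p :* q₀ :+ p :* q₁)) refl

    dominoRelation : InSpan n (λ x y → (1# + 1#) * ε x y + - (⟨ M ⟩ * δ x y))
    dominoRelation = InSpan-resp (λ x y → identity (cell 0 x) (cell 1 x) (cell 2 x) (cell 0 y) (cell 1 y) (cell M y) ⟨ M ⟩)
                       (InSpan-+ (InSpan-+ rowTriple (InSpan-* (- 1#) cornerDifference))
                                 (InSpan-* (- 1#) (proj₁ (cellRelations (suc i)))))
      where
      identity : ∀ p₀ p₁ p₂ q₀ q₁ qₘ m →
        (p₀ + (p₁ + p₁) + p₂) * q₀ + - 1# * (p₂ * q₀ + - (p₀ * qₘ))
          + - 1# * (p₀ * qₘ + - (p₀ * q₀) + m * (p₀ * q₀ + p₀ * q₁))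
        ≈ (1# + 1#) * (p₀ * q₀ + p₁ * q₀) + - (m * (p₀ * q₀ + p₀ * q₁))
      identity = solve 7 (λ p₀ p₁ p₂ q₀ q₁ qₘ m →
        (p₀ :+ (p₁ :+ p₁) :+ p₂) :* q₀ :+ con (ℤ.- + 1) :* (p₂ :* q₀ :- p₀ :* qₘ)
          :+ con (ℤ.- + 1) :* (p₀ :* qₘ :- p₀ :* q₀ :+ m :* (p₀ :* q₀ :+ p₀ :* q₁))
        := con (+ 2) :* (p₀ :* q₀ :+ p₁ :* q₀) :- m :* (p₀ :* q₀ :+ p₀ :* q₁)) refl

    -- The relation and its transpose eliminate δ.
    fourMinusSquare : InSpan n (λ x y → ((1# + 1#) * (1# + 1#) + - (⟨ M ⟩ * ⟨ M ⟩)) * ε x y)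
    fourMinusSquare = InSpan-resp (λ x y → identity (cell 0 x) (cell 1 x) (cell 0 y) (cell 1 y) ⟨ M ⟩)
                        (InSpan-+ (InSpan-* ⟨ M ⟩ (InSpan-transpose dominoRelation)) (InSpan-* (1# + 1#) dominoRelation))
      where
      identity : ∀ p₀ p₁ q₀ q₁ m →
        m * ((1# + 1#) * (q₀ * p₀ + q₁ * p₀) + - (m * (q₀ * p₀ + q₀ * p₁)))
          + (1# + 1#) * ((1# + 1#) * (p₀ * q₀ + p₁ * q₀) + - (m * (p₀ * q₀ + p₀ * q₁)))
        ≈ ((1# + 1#) * (1# + 1#) + - (m * m)) * (p₀ * q₀ + p₁ * q₀)
      identity = solve 5 (λ p₀ p₁ q₀ q₁ m →
        m :* (con (+ 2) :* (q₀ :* p₀ :+ q₁ :* p₀) :- m :* (q₀ :* p₀ :+ q₀ :* p₁))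
          :+ con (+ 2) :* (con (+ 2) :* (p₀ :* q₀ :+ p₁ :* q₀) :- m :* (p₀ :* q₀ :+ p₀ :* q₁))
        := (con (+ 2) :* con (+ 2) :- m :* m) :* (p₀ :* q₀ :+ p₁ :* q₀)) refl

  -- 4 - M² = -(M - 2)(M + 2), and both factors are nonzero once M ≥ 4.
  InSpan-domino : ∀ t → InSpan (suc (suc (suc (suc t) ℕ.* 2))) (λ x y → block 0 1 x * block 0 0 y)
  InSpan-domino t =
    InSpan-resp (λ x y → begin
        - (a′ * b′) * (((1# + 1#) * (1# + 1#) + - (⟨ M ⟩ * ⟨ M ⟩)) * ε x y)   ≈⟨ identity A a′ b′ (ε x y) ⟩
        (A * a′) * (B * b′) * ε x y                                          ≈⟨ *-congʳ (*-cong Aa′≈1 Bb′≈1) ⟩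
        1# * 1# * ε x y                                                      ≈⟨ trans (*-congʳ (*-identityˡ 1#)) (*-identityˡ _) ⟩
        ε x y                                                                ≈⟨ distribʳ _ _ _ ⟨
        (cell 0 x + cell 1 x) * cell 0 y                                     ≈⟨ *-congʳ (block-suc 0 0 x) ⟨
        block 0 1 x * block 0 0 y                                            ∎)
      (InSpan-* (- (a′ * b′)) fourMinusSquare)
    where
    open DominoConstruction (suc t)
    A B a′ b′ : Carrier
    A = ⟨ suc t ℕ.* 2 ⟩
    B = ⟨ suc (suc (suc (suc t) ℕ.* 2)) ⟩
    a′ = proj₁ (inverse A (charZero (suc (t ℕ.* 2))))
    b′ = proj₁ (inverse B (charZero (suc (suc (suc t) ℕ.* 2))))
    Aa′≈1 : A * a′ ≈ 1#
    Aa′≈1 = proj₂ (inverse A (charZero (suc (t ℕ.* 2))))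
    Bb′≈1 : B * b′ ≈ 1#
    Bb′≈1 = proj₂ (inverse B (charZero (suc (suc (suc t) ℕ.* 2))))
    identity : ∀ a a′ b′ f →
      - (a′ * b′) * (((1# + 1#) * (1# + 1#) + - ((1# + (1# + a)) * (1# + (1# + a)))) * f)
      ≈ (a * a′) * ((1# + (1# + (1# + (1# + a)))) * b′) * f
    identity = solve 4 (λ a a′ b′ f →
      (:- (a′ :* b′)) :* ((con (+ 2) :* con (+ 2) :- (one :+ (one :+ a)) :* (one :+ (one :+ a))) :* f)
      := (a :* a′) :* ((one :+ (one :+ (one :+ (one :+ a)))) :* b′) :* f) refl
      where
      one : ∀ {m} → Polynomial m
      one = con (+ 1)

  stack-x : ∀ {n} (G : ℤ → Carrier) → InSpan n (λ x y → block 0 1 x * G y) →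
            ∀ u → InSpan n (λ x y → block 0 (u ℕ.* 2 ℕ.+ 1) x * G y)
  stack-x G strip u =
    InSpan-resp (λ x y → *-comm _ _)
      (InSpan-transpose (stack-y G 1 (InSpan-resp (λ x y → *-comm _ _) (InSpan-transpose strip)) u))

  SignedTileable-block : ∀ {n p q} → InSpan n (λ x y → block 0 p x * block 0 q y) → SignedTileable K n (suc p) (suc q)
  SignedTileable-block {p = p} {q} = InSpan-resp (λ x y → sym (rectangle-indicator p q x y))

  SignedTileable-transpose : ∀ {n} p q → SignedTileable K n p q → SignedTileable K n q p
  SignedTileable-transpose p q =
    InSpan-resp (λ x y → ⟦≡⟧ (∧-comm (inRange (+ p ℤ.- + 1) y) (inRange (+ q ℤ.- + 1) x))) ∘ InSpan-transpose

  SignedTileable-even-side : ∀ t u q → SignedTileable K (suc (suc (suc (suc t) ℕ.* 2))) (suc u ℕ.* 2) (suc q)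
  SignedTileable-even-side t u q = SignedTileable-block (InSpan-resp shape (stack-x (block 0 q) strip u))
    where
    q*1+0≡q : q ℕ.* 1 ℕ.+ 0 ≡ q
    q*1+0≡q = ≡.trans (ℕP.+-identityʳ (q ℕ.* 1)) (ℕP.*-identityʳ q)
    strip : InSpan (suc (suc (suc (suc t) ℕ.* 2))) (λ x y → block 0 1 x * block 0 q y)
    strip = InSpan-resp (λ x y → *-congˡ (⟦≡⟧ (≡.cong (λ m → inRange (+ m) (y ℤ.- + 0)) q*1+0≡q)))
                        (stack-y (block 0 1) 0 (InSpan-domino t) q)
    shape : ∀ x y → block 0 (u ℕ.* 2 ℕ.+ 1) x * block 0 q y ≈ block 0 (suc (u ℕ.* 2)) x * block 0 q y
    shape x y = *-congʳ (block-odd 0 u x)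

  SignedTileable-even-even : ∀ u v → SignedTileable K 4 (suc u ℕ.* 2) (suc v ℕ.* 2)
  SignedTileable-even-even u v = SignedTileable-block (InSpan-resp shape (stack-x (block 0 (v ℕ.* 2 ℕ.+ 1)) strip u))
    where
    strip : InSpan 4 (λ x y → block 0 1 x * block 0 (v ℕ.* 2 ℕ.+ 1) y)
    strip = stack-y (block 0 1) 1 (InSpan-square 4) v
    shape : ∀ x y → block 0 (u ℕ.* 2 ℕ.+ 1) x * block 0 (v ℕ.* 2 ℕ.+ 1) y ≈ block 0 (suc (u ℕ.* 2)) x * block 0 (suc (v ℕ.* 2)) y
    shape x y = *-cong (block-odd 0 u x) (block-odd 0 v y)

  +-middle-swap : ∀ a b u v → a + b + (u + v) ≈ a + u + (b + v)
  +-middle-swap = solve-∀ ring⁺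

  ∑ : ℕ → (ℕ → Carrier) → Carrier
  ∑ zero    f = 0#
  ∑ (suc L) f = f 0 + ∑ L (λ t → f (suc t))

  ∑-cong< : ∀ L {f g : ℕ → Carrier} → (∀ t → t ℕ.< L → f t ≈ g t) → ∑ L f ≈ ∑ L g
  ∑-cong< zero    f≈g = refl
  ∑-cong< (suc L) f≈g = +-cong (f≈g 0 (s≤s z≤n)) (∑-cong< L (λ t t<L → f≈g (suc t) (s≤s t<L)))

  ∑-cong : ∀ L {f g : ℕ → Carrier} → (∀ t → f t ≈ g t) → ∑ L f ≈ ∑ L g
  ∑-cong L f≈g = ∑-cong< L (λ t _ → f≈g t)

  ∑-zero< : ∀ L {f : ℕ → Carrier} → (∀ t → t ℕ.< L → f t ≈ 0#) → ∑ L f ≈ 0#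
  ∑-zero< zero    f≈0 = refl
  ∑-zero< (suc L) f≈0 = trans (+-cong (f≈0 0 (s≤s z≤n)) (∑-zero< L (λ t t<L → f≈0 (suc t) (s≤s t<L)))) (+-identityˡ 0#)

  ∑-+ : ∀ L (f g : ℕ → Carrier) → ∑ L (λ t → f t + g t) ≈ ∑ L f + ∑ L g
  ∑-+ zero    f g = sym (+-identityˡ 0#)
  ∑-+ (suc L) f g = trans (+-congˡ (∑-+ L _ _)) (+-middle-swap (f 0) (g 0) _ _)

  ∑-*ˡ : ∀ L a (f : ℕ → Carrier) → ∑ L (λ t → a * f t) ≈ a * ∑ L f
  ∑-*ˡ zero    a f = sym (zeroʳ a)
  ∑-*ˡ (suc L) a f = trans (+-congˡ (∑-*ˡ L a _)) (sym (distribˡ a _ _))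

  ∑-*ʳ : ∀ L a (f : ℕ → Carrier) → ∑ L (λ t → f t * a) ≈ ∑ L f * a
  ∑-*ʳ L a f = trans (∑-cong L (λ t → *-comm (f t) a)) (trans (∑-*ˡ L a f) (*-comm a _))

  ∑-split : ∀ d L (f : ℕ → Carrier) → ∑ (d ℕ.+ L) f ≈ ∑ d f + ∑ L (λ t → f (d ℕ.+ t))
  ∑-split zero    L f = sym (+-identityˡ _)
  ∑-split (suc d) L f = trans (+-congˡ (∑-split d L _)) (sym (+-assoc _ _ _))

  ∑-snoc : ∀ L (f : ℕ → Carrier) → ∑ (suc L) f ≈ ∑ L f + f L
  ∑-snoc L f = begin
    ∑ (suc L) f                                ≡⟨ ≡.cong (λ m → ∑ m f) (ℕP.+-comm 1 L) ⟩
    ∑ (L ℕ.+ 1) f                              ≈⟨ ∑-split L 1 f ⟩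
    ∑ L f + (f (L ℕ.+ 0) + 0#)                  ≈⟨ +-congˡ (trans (+-identityʳ _) (≡⇒≈ (≡.cong f (ℕP.+-identityʳ L)))) ⟩
    ∑ L f + f L                                ∎

  ∑-snoc₂ : ∀ L (f : ℕ → Carrier) → ∑ (suc (suc L)) f ≈ ∑ L f + f L + f (suc L)
  ∑-snoc₂ L f = trans (∑-snoc (suc L) f) (+-congʳ (∑-snoc L f))

  lo+[m+n]≡lo+m+n : ∀ lo m n → lo ℤ.+ + (m ℕ.+ n) ≡ (lo ℤ.+ + m) ℤ.+ + n
  lo+[m+n]≡lo+m+n lo m n = ≡.sym (ℤP.+-assoc lo (+ m) (+ n))

  -- The interval [a, a + k] of length k + 1 lies within the L integers starting at lo.
  FitsIn : ℤ → ℕ → ℤ → ℕ → Set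
  FitsIn lo L a k = Σ ℕ λ d → Σ ℕ λ e → (a ≡ lo ℤ.+ + d) × (L ≡ d ℕ.+ (suc k ℕ.+ e))

  lo+m+n-[lo+m]≡n : ∀ lo m n → (lo ℤ.+ + (m ℕ.+ n)) ℤ.- (lo ℤ.+ + m) ≡ + n
  lo+m+n-[lo+m]≡n lo m n = cancel lo (+ m) (+ n)
    where
    cancel : ∀ lo m n → (lo ℤ.+ (m ℤ.+ n)) ℤ.- (lo ℤ.+ m) ≡ n
    cancel = ℤSolver.solve-∀

  lo+m-[lo+m+n]≡-n : ∀ lo m n → (lo ℤ.+ + m) ℤ.- (lo ℤ.+ + (m ℕ.+ n)) ≡ ℤ.- + n
  lo+m-[lo+m+n]≡-n lo m n = cancel lo (+ m) (+ n)
    where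
    cancel : ∀ lo m n → (lo ℤ.+ m) ℤ.- (lo ℤ.+ (m ℤ.+ n)) ≡ ℤ.- n
    cancel = ℤSolver.solve-∀

  ∑-interval : ∀ lo L a k (F : ℤ → Carrier) → FitsIn lo L a k →
    ∑ L (λ t → interval k ((lo ℤ.+ + t) ℤ.- a) * F (lo ℤ.+ + t)) ≈ ∑ (suc k) (λ j → F (a ℤ.+ + j))
  ∑-interval lo _ _ k F (d , e , ≡.refl , ≡.refl) = begin
    ∑ (d ℕ.+ (suc k ℕ.+ e)) f
      ≈⟨ ∑-split d _ f ⟩
    ∑ d f + ∑ (suc k ℕ.+ e) (λ t → f (d ℕ.+ t))
      ≈⟨ +-cong (∑-zero< d before) (∑-split (suc k) e (λ t → f (d ℕ.+ t))) ⟩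
    0# + (∑ (suc k) (λ j → f (d ℕ.+ j)) + ∑ e (λ j → f (d ℕ.+ (suc k ℕ.+ j))))
      ≈⟨ trans (+-identityˡ _) (+-cong (∑-cong< (suc k) inside) (∑-zero< e (λ j _ → after j))) ⟩
    ∑ (suc k) (λ j → F ((lo ℤ.+ + d) ℤ.+ + j)) + 0#
      ≈⟨ +-identityʳ _ ⟩
    ∑ (suc k) (λ j → F ((lo ℤ.+ + d) ℤ.+ + j))
      ∎
    where
    f : ℕ → Carrier
    f t = interval k ((lo ℤ.+ + t) ℤ.- (lo ℤ.+ + d)) * F (lo ℤ.+ + t)
    vanishes : ∀ {t} → inRange (+ k) ((lo ℤ.+ + t) ℤ.- (lo ℤ.+ + d)) ≡ false → f t ≈ 0#
    vanishes out = trans (*-congʳ (⟦≡⟧ out)) (zeroˡ _)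
    before : ∀ t → t ℕ.< d → f t ≈ 0#
    before t t<d = vanishes (≡.cong (inRange (+ k))
      (≡.trans (≡.cong (λ m → (lo ℤ.+ + t) ℤ.- (lo ℤ.+ + m)) (≡.sym (≡.trans (ℕP.+-suc t _) (ℕP.m+[n∸m]≡n t<d))))
               (lo+m-[lo+m+n]≡-n lo t (suc (d ℕ.∸ suc t)))))
    inside : ∀ j → j ℕ.< suc k → f (d ℕ.+ j) ≈ F ((lo ℤ.+ + d) ℤ.+ + j)
    inside j (s≤s j≤k) = begin
      interval k ((lo ℤ.+ + (d ℕ.+ j)) ℤ.- (lo ℤ.+ + d)) * F (lo ℤ.+ + (d ℕ.+ j))
        ≈⟨ *-cong (⟦≡⟧ (≡.trans (≡.cong (inRange (+ k)) (lo+m+n-[lo+m]≡n lo d j))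
                                (≡.trans (inRange-+ k j) (≤⇒≤ᵇ≡true j≤k))))
                  (≡⇒≈ (≡.cong F (lo+[m+n]≡lo+m+n lo d j))) ⟩
      1# * F ((lo ℤ.+ + d) ℤ.+ + j)
        ≈⟨ *-identityˡ _ ⟩
      F ((lo ℤ.+ + d) ℤ.+ + j) ∎
    after : ∀ j → f (d ℕ.+ (suc k ℕ.+ j)) ≈ 0#
    after j = vanishes (≡.trans (≡.cong (inRange (+ k)) (lo+m+n-[lo+m]≡n lo d (suc k ℕ.+ j)))
                                (≡.trans (inRange-+ k (suc k ℕ.+ j)) (suc+≤ᵇ≡false k j)))

  windowStart : ℕ → ℤ
  windowStart N = ℤ.- + N

  windowWidth : ℕ → ℕ
  windowWidth N = N ℕ.+ N ℕ.+ suc N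

  windowSum : ℕ → (ℤ → ℤ → Carrier) → Carrier
  windowSum N F = ∑ (windowWidth N) λ t → ∑ (windowWidth N) λ u → F (windowStart N ℤ.+ + t) (windowStart N ℤ.+ + u)

  windowSum-cong : ∀ N {F G : ℤ → ℤ → Carrier} → (∀ x y → F x y ≈ G x y) → windowSum N F ≈ windowSum N G
  windowSum-cong N F≈G = ∑-cong (windowWidth N) (λ t → ∑-cong (windowWidth N) (λ u → F≈G _ _))

  windowSum-+ : ∀ N (F G : ℤ → ℤ → Carrier) → windowSum N (λ x y → F x y + G x y) ≈ windowSum N F + windowSum N G
  windowSum-+ N F G = trans (∑-cong (windowWidth N) (λ t → ∑-+ (windowWidth N) (F _ ∘ y) (G _ ∘ y))) (∑-+ (windowWidth N) _ _)
    where
    y : ℕ → ℤ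
    y u = windowStart N ℤ.+ + u

  windowSum-*ˡ : ∀ N a (F : ℤ → ℤ → Carrier) → windowSum N (λ x y → a * F x y) ≈ a * windowSum N F
  windowSum-*ˡ N a F = trans (∑-cong (windowWidth N) (λ t → ∑-*ˡ (windowWidth N) a (F _ ∘ y))) (∑-*ˡ (windowWidth N) a _)
    where
    y : ℕ → ℤ
    y u = windowStart N ℤ.+ + u

  windowSum-zero : ∀ N → windowSum N (λ _ _ → 0#) ≈ 0#
  windowSum-zero N = ∑-zero< (windowWidth N) (λ t _ → ∑-zero< (windowWidth N) (λ u _ → refl))

  windowSum-block : ∀ N (Φ : ℤ → ℤ → Carrier) a k₁ b k₂ →
    FitsIn (windowStart N) (windowWidth N) a k₁ → FitsIn (windowStart N) (windowWidth N) b k₂ →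
    windowSum N (λ x y → Φ x y * (interval k₁ (x ℤ.- a) * interval k₂ (y ℤ.- b)))
      ≈ ∑ (suc k₁) (λ i → ∑ (suc k₂) (λ j → Φ (a ℤ.+ + i) (b ℤ.+ + j)))
  windowSum-block N Φ a k₁ b k₂ a-fits b-fits =
    trans (∑-cong (windowWidth N) λ t →
             trans (∑-cong (windowWidth N) (λ u → rearrange (Φ (x t) (x u)) (interval k₁ (x t ℤ.- a)) (interval k₂ (x u ℤ.- b))))
                   (trans (∑-*ˡ (windowWidth N) _ _) (*-congˡ (∑-interval (windowStart N) (windowWidth N) b k₂ (Φ (x t)) b-fits))))
          (∑-interval (windowStart N) (windowWidth N) a k₁ (λ x → ∑ (suc k₂) (λ j → Φ x (b ℤ.+ + j))) a-fits)
    where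
    x : ℕ → ℤ
    x u = windowStart N ℤ.+ + u
    rearrange : ∀ f u v → f * (u * v) ≈ u * (v * f)
    rearrange = solve-∀ ring⁺

  fitsInWindow : ∀ N M a c k → ℤ.∣ a ∣ ℕ.≤ N → c ℕ.+ k ℕ.≤ M → FitsIn (windowStart N) (N ℕ.+ N ℕ.+ suc M) (+ c ℤ.+ a) k
  fitsInWindow N M (+ m) c k m≤N c+k≤M
    with N ℕ.∸ m | ℕP.m+[n∸m]≡n m≤N | M ℕ.∸ (c ℕ.+ k) | ℕP.m+[n∸m]≡n c+k≤M
  ... | N₁ | ≡.refl | M₁ | ≡.refl =
    (m ℕ.+ N₁) ℕ.+ (m ℕ.+ c) , N₁ ℕ.+ M₁ ,
    ℤ-identity (+ m) (+ N₁) (+ c) ,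
    ℕ-identity m N₁ c k M₁
    where
    ℤ-identity : ∀ m N₁ c → c ℤ.+ m ≡ ℤ.- (m ℤ.+ N₁) ℤ.+ ((m ℤ.+ N₁) ℤ.+ (m ℤ.+ c))
    ℤ-identity = ℤSolver.solve-∀
    ℕ-identity : ∀ m N₁ c k M₁ →
      (m ℕ.+ N₁) ℕ.+ (m ℕ.+ N₁) ℕ.+ suc ((c ℕ.+ k) ℕ.+ M₁)
      ≡ ((m ℕ.+ N₁) ℕ.+ (m ℕ.+ c)) ℕ.+ (suc k ℕ.+ (N₁ ℕ.+ M₁))
    ℕ-identity = ℕSolver.solve-∀
  fitsInWindow N M -[1+ m ] c k m<N c+k≤M
    with N ℕ.∸ suc m | ℕP.m+[n∸m]≡n m<N | M ℕ.∸ (c ℕ.+ k) | ℕP.m+[n∸m]≡n c+k≤M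
  ... | N₁ | ≡.refl | M₁ | ≡.refl =
    N₁ ℕ.+ c , (suc m ℕ.+ N₁) ℕ.+ suc m ℕ.+ M₁ ,
    ℤ-identity (+ suc m) (+ N₁) (+ c) ,
    ℕ-identity m N₁ c k M₁
    where
    ℤ-identity : ∀ m′ N₁ c → c ℤ.+ ℤ.- m′ ≡ ℤ.- (m′ ℤ.+ N₁) ℤ.+ (N₁ ℤ.+ c)
    ℤ-identity = ℤSolver.solve-∀
    ℕ-identity : ∀ m N₁ c k M₁ →
      (suc m ℕ.+ N₁) ℕ.+ (suc m ℕ.+ N₁) ℕ.+ suc ((c ℕ.+ k) ℕ.+ M₁)
      ≡ (N₁ ℕ.+ c) ℕ.+ (suc k ℕ.+ ((suc m ℕ.+ N₁) ℕ.+ suc m ℕ.+ M₁))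
    ℕ-identity = ℕSolver.solve-∀

  -- Necessity

  rectMass : (ℕ → Carrier) → Rect → Carrier
  rectMass h (c₁ , k₁ , c₂ , k₂) = ∑ (suc k₁) λ i → ∑ (suc k₂) λ j → h (c₁ ℕ.+ c₂ ℕ.+ i ℕ.+ j)

  rectsMass : (ℕ → Carrier) → List Rect → Carrier
  rectsMass h []       = 0#
  rectsMass h (r ∷ rs) = rectMass h r + rectsMass h rs

  BoundedBy : ℕ → Rect → Set
  BoundedBy M (c₁ , k₁ , c₂ , k₂) = c₁ ℕ.+ k₁ ℕ.≤ M × c₂ ℕ.+ k₂ ℕ.≤ M

  shapeRects-bounded : ∀ M s → 1 ℕ.≤ M → All (BoundedBy M) (shapeRects M s)
  shapeRects-bounded M F.zero                                 1≤M = (z≤n , ℕP.≤-refl) ∷ (1≤M , z≤n) ∷ []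
  shapeRects-bounded M (F.suc F.zero)                         1≤M = (1≤M , ℕP.≤-refl) ∷ (z≤n , M+0≤M) ∷ []
    where
    M+0≤M : M ℕ.+ 0 ℕ.≤ M
    M+0≤M = ℕP.≤-reflexive (ℕP.+-identityʳ M)
  shapeRects-bounded M (F.suc (F.suc F.zero))                 1≤M = (ℕP.≤-refl , z≤n) ∷ (z≤n , 1≤M) ∷ []
  shapeRects-bounded M (F.suc (F.suc (F.suc F.zero)))         1≤M = (ℕP.≤-refl , 1≤M) ∷ (M+0≤M , z≤n) ∷ []
    where
    M+0≤M : M ℕ.+ 0 ℕ.≤ M
    M+0≤M = ℕP.≤-reflexive (ℕP.+-identityʳ M)
  shapeRects-bounded M (F.suc (F.suc (F.suc (F.suc F.zero)))) 1≤M = (1≤M , 1≤M) ∷ []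

  windowSum-rects : ∀ N (g : ℤ → Carrier) a b rs → ℤ.∣ a ∣ ℕ.≤ N → ℤ.∣ b ∣ ℕ.≤ N → All (BoundedBy N) rs →
    windowSum N (λ x y → g (x ℤ.+ y) * rectsIndicator rs (x ℤ.- a) (y ℤ.- b)) ≈ rectsMass (λ m → g (a ℤ.+ b ℤ.+ + m)) rs
  windowSum-rects N g a b []                        ∣a∣≤N ∣b∣≤N []                 =
    trans (windowSum-cong N (λ x y → zeroʳ (g (x ℤ.+ y)))) (windowSum-zero N)
  windowSum-rects N g a b ((c₁ , k₁ , c₂ , k₂) ∷ rs) ∣a∣≤N ∣b∣≤N ((b₁ , b₂) ∷ bounded) = begin
    windowSum N (λ x y → Φ x y * (R x y + Rs x y))
      ≈⟨ windowSum-cong N (λ x y → distribˡ (Φ x y) (R x y) (Rs x y)) ⟩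
    windowSum N (λ x y → Φ x y * R x y + Φ x y * Rs x y)
      ≈⟨ windowSum-+ N (λ x y → Φ x y * R x y) (λ x y → Φ x y * Rs x y) ⟩
    windowSum N (λ x y → Φ x y * R x y) + windowSum N (λ x y → Φ x y * Rs x y)
      ≈⟨ +-cong (trans (windowSum-cong N (λ x y → *-cong (refl {x = Φ x y}) (*-cong (offset x a c₁ k₁) (offset y b c₂ k₂))))
                       (windowSum-block N Φ (+ c₁ ℤ.+ a) k₁ (+ c₂ ℤ.+ b) k₂
                                        (fitsInWindow N N a c₁ k₁ ∣a∣≤N b₁) (fitsInWindow N N b c₂ k₂ ∣b∣≤N b₂)))
                (windowSum-rects N g a b rs ∣a∣≤N ∣b∣≤N bounded) ⟩
    ∑ (suc k₁) (λ i → ∑ (suc k₂) (λ j → g ((+ c₁ ℤ.+ a ℤ.+ + i) ℤ.+ (+ c₂ ℤ.+ b ℤ.+ + j)))) + rectsMass h rs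
      ≈⟨ +-congʳ (∑-cong (suc k₁) (λ i → ∑-cong (suc k₂) (λ j → ≡⇒≈ (≡.cong g (reassociate a b (+ c₁) (+ c₂) (+ i) (+ j)))))) ⟩
    rectMass h r + rectsMass h rs ∎
    where
    r : Rect
    r = (c₁ , k₁ , c₂ , k₂)
    h : ℕ → Carrier
    h m = g (a ℤ.+ b ℤ.+ + m)
    Φ R Rs : ℤ → ℤ → Carrier
    Φ x y = g (x ℤ.+ y)
    R x y = rectIndicator r (x ℤ.- a) (y ℤ.- b)
    Rs x y = rectsIndicator rs (x ℤ.- a) (y ℤ.- b)
    offset : ∀ x a c k → block c k (x ℤ.- a) ≈ interval k (x ℤ.- (+ c ℤ.+ a))
    offset x a c k = ⟦≡⟧ (≡.cong (inRange (+ k)) (≡.sym (x-[a+c]≡x-c-a x (+ c) a)))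
    reassociate : ∀ a b c₁ c₂ i j → (c₁ ℤ.+ a ℤ.+ i) ℤ.+ (c₂ ℤ.+ b ℤ.+ j) ≡ a ℤ.+ b ℤ.+ (c₁ ℤ.+ c₂ ℤ.+ i ℤ.+ j)
    reassociate = ℤSolver.solve-∀

  translationBound : Tiles → ℕ
  translationBound []                    = 0
  translationBound ((s , a , b , w) ∷ ts) = ℤ.∣ a ∣ ℕ.+ ℤ.∣ b ∣ ℕ.+ translationBound ts

  -- The mass of g(x + y) on the tile s translated by (a, b) depends only on T = a + b.
  ZeroMassOnTiles : ℕ → (ℤ → Carrier) → Set ℓ
  ZeroMassOnTiles n g = ∀ s T → rectsMass (λ m → g (T ℤ.+ + m)) (shapeRects (n ℕ.∸ 2) s) ≈ 0#

  distribute : ∀ f u w r → f * (u * w + r) ≈ w * (f * u) + f * r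
  distribute = solve 4 (λ f u w r → f :* (u :* w :+ r) := w :* (f :* u) :+ f :* r) refl

  windowSum-tiles : ∀ n (g : ℤ → Carrier) N ts → 1 ℕ.≤ n ℕ.∸ 2 → n ℕ.∸ 2 ℕ.≤ N → translationBound ts ℕ.≤ N →
    ZeroMassOnTiles n g → windowSum N (λ x y → g (x ℤ.+ y) * weightAt K n ts x y) ≈ 0#
  windowSum-tiles n g N []                    _   _   _       _    =
    trans (windowSum-cong N (λ x y → zeroʳ (g (x ℤ.+ y)))) (windowSum-zero N)
  windowSum-tiles n g N ((s , a , b , w) ∷ ts) 1≤M M≤N bound≤N massless = begin
    windowSum N (λ x y → g (x ℤ.+ y) * ((if covers n s a b x y then w else 0#) + weightAt K n ts x y))
      ≈⟨ windowSum-cong N (λ x y → trans (*-congˡ (+-congʳ (trans (if-then-0 _ w) (*-congʳ (shapeCell-rects n s _ _)))))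
                                         (distribute (g (x ℤ.+ y)) (R x y) w (weightAt K n ts x y))) ⟩
    windowSum N (λ x y → w * (g (x ℤ.+ y) * R x y) + g (x ℤ.+ y) * weightAt K n ts x y)
      ≈⟨ windowSum-+ N (λ x y → w * (g (x ℤ.+ y) * R x y)) (λ x y → g (x ℤ.+ y) * weightAt K n ts x y) ⟩
    windowSum N (λ x y → w * (g (x ℤ.+ y) * R x y)) + windowSum N (λ x y → g (x ℤ.+ y) * weightAt K n ts x y)
      ≈⟨ +-cong (trans (windowSum-*ˡ N w (λ x y → g (x ℤ.+ y) * R x y))
                       (*-congˡ (trans (windowSum-rects N g a b _ ∣a∣≤N ∣b∣≤N bounded) (massless s (a ℤ.+ b)))))
                (windowSum-tiles n g N ts 1≤M M≤N (ℕP.≤-trans (ℕP.m≤n+m _ (ℤ.∣ a ∣ ℕ.+ ℤ.∣ b ∣)) bound≤N) massless) ⟩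
    w * 0# + 0#
      ≈⟨ trans (+-identityʳ _) (zeroʳ w) ⟩
    0# ∎
    where
    R : ℤ → ℤ → Carrier
    R x y = rectsIndicator (shapeRects (n ℕ.∸ 2) s) (x ℤ.- a) (y ℤ.- b)
    ∣a∣+∣b∣≤N : ℤ.∣ a ∣ ℕ.+ ℤ.∣ b ∣ ℕ.≤ N
    ∣a∣+∣b∣≤N = ℕP.≤-trans (ℕP.m≤m+n (ℤ.∣ a ∣ ℕ.+ ℤ.∣ b ∣) _) bound≤N
    ∣a∣≤N : ℤ.∣ a ∣ ℕ.≤ N
    ∣a∣≤N = ℕP.≤-trans (ℕP.m≤m+n ℤ.∣ a ∣ ℤ.∣ b ∣) ∣a∣+∣b∣≤N
    ∣b∣≤N : ℤ.∣ b ∣ ℕ.≤ N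
    ∣b∣≤N = ℕP.≤-trans (ℕP.m≤n+m ℤ.∣ b ∣ ℤ.∣ a ∣) ∣a∣+∣b∣≤N
    bounded : All (BoundedBy N) (shapeRects (n ℕ.∸ 2) s)
    bounded = All.map (λ { (b₁ , b₂) → ℕP.≤-trans b₁ M≤N , ℕP.≤-trans b₂ M≤N }) (shapeRects-bounded (n ℕ.∸ 2) s 1≤M)

  rectangleMass≈0 : ∀ n (g : ℤ → Carrier) → 1 ℕ.≤ n ℕ.∸ 2 → ZeroMassOnTiles n g →
    ∀ p q → SignedTileable K n (suc p) (suc q) → ∑ (suc p) (λ i → ∑ (suc q) (λ j → g (+ (i ℕ.+ j)))) ≈ 0#
  rectangleMass≈0 n g 1≤M massless p q (ts , tiling) = begin
    ∑ (suc p) (λ i → ∑ (suc q) (λ j → g (+ (i ℕ.+ j))))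
      ≈⟨ windowSum-block N Φ (+ 0) p (+ 0) q (fitsInWindow N N (+ 0) 0 p z≤n p≤N) (fitsInWindow N N (+ 0) 0 q z≤n q≤N) ⟨
    windowSum N (λ x y → Φ x y * (block 0 p x * block 0 q y))
      ≈⟨ windowSum-cong N (λ x y → *-cong (refl {x = Φ x y}) (sym (trans (tiling x y) (rectangle-indicator p q x y)))) ⟩
    windowSum N (λ x y → Φ x y * weightAt K n ts x y)
      ≈⟨ windowSum-tiles n g N ts 1≤M (ℕP.m≤n+m _ _) (ℕP.≤-trans (ℕP.m≤m+n _ (p ℕ.+ q)) (ℕP.m≤m+n _ _)) massless ⟩
    0# ∎
    where
    N : ℕ
    N = translationBound ts ℕ.+ (p ℕ.+ q) ℕ.+ (n ℕ.∸ 2)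
    Φ : ℤ → ℤ → Carrier
    Φ x y = g (x ℤ.+ y)
    p+q≤N : p ℕ.+ q ℕ.≤ N
    p+q≤N = ℕP.≤-trans (ℕP.m≤n+m (p ℕ.+ q) (translationBound ts)) (ℕP.m≤m+n _ _)
    p≤N : p ℕ.≤ N
    p≤N = ℕP.≤-trans (ℕP.m≤m+n p q) p+q≤N
    q≤N : q ℕ.≤ N
    q≤N = ℕP.≤-trans (ℕP.m≤n+m q p) p+q≤N

  -- The weights (-1)ᶻ and (-1)ᶻ z

  alt : ℕ → Carrier
  alt zero    = 1#
  alt (suc m) = - alt m

  altι : ℕ → Carrier
  altι m = alt m * fromℕ m

  σ : ℤ → Carrier
  σ (+ m)    = alt m
  σ -[1+ m ] = alt (suc m)

  alt-+ : ∀ m k → alt (m ℕ.+ k) ≈ alt m * alt k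
  alt-+ zero    k = sym (*-identityˡ _)
  alt-+ (suc m) k = trans (-‿cong (alt-+ m k)) (-‿distribˡ-* (alt m) (alt k))

  alt-even : ∀ u → alt (u ℕ.* 2) ≈ 1#
  alt-even zero    = refl
  alt-even (suc u) = trans (-‿involutive _) (alt-even u)

  σ-suc : ∀ z → σ (+ 1 ℤ.+ z) ≈ - σ z
  σ-suc (+ m)           = refl
  σ-suc -[1+ zero ]     = sym (-‿involutive 1#)
  σ-suc -[1+ suc m ]    = sym (-‿involutive _)

  σ-shift : ∀ T m → σ (T ℤ.+ + m) ≈ alt m * σ T
  σ-shift T zero    = trans (≡⇒≈ (≡.cong σ (ℤP.+-identityʳ T))) (sym (*-identityˡ _))
  σ-shift T (suc m) = begin
    σ (T ℤ.+ + suc m)      ≡⟨ ≡.cong σ (shift T (+ m)) ⟩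
    σ (+ 1 ℤ.+ (T ℤ.+ + m)) ≈⟨ σ-suc (T ℤ.+ + m) ⟩
    - σ (T ℤ.+ + m)        ≈⟨ -‿cong (σ-shift T m) ⟩
    - (alt m * σ T)        ≈⟨ -‿distribˡ-* (alt m) (σ T) ⟩
    alt (suc m) * σ T      ∎
    where
    shift : ∀ T m → T ℤ.+ (+ 1 ℤ.+ m) ≡ + 1 ℤ.+ (T ℤ.+ m)
    shift = ℤSolver.solve-∀

  ∑-alt-odd : ∀ u → ∑ (suc (u ℕ.* 2)) alt ≈ 1#
  ∑-alt-odd zero    = +-identityʳ 1#
  ∑-alt-odd (suc u) = begin
    ∑ (suc (suc (suc (u ℕ.* 2)))) alt                                   ≈⟨ ∑-snoc₂ (suc (u ℕ.* 2)) alt ⟩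
    ∑ (suc (u ℕ.* 2)) alt + alt (suc (u ℕ.* 2)) + alt (suc (suc (u ℕ.* 2))) ≈⟨ +-congʳ (+-congʳ (∑-alt-odd u)) ⟩
    1# + - alt (u ℕ.* 2) + - - alt (u ℕ.* 2)                             ≈⟨ cancel (alt (u ℕ.* 2)) ⟩
    1#                                                                  ∎
    where
    cancel : ∀ a → 1# + - a + - - a ≈ 1#
    cancel = solve 1 (λ a → con (+ 1) :- a :+ (:- (:- a)) := con (+ 1)) refl

  ∑-alt-even : ∀ u → ∑ (u ℕ.* 2) alt ≈ 0#
  ∑-alt-even zero    = refl
  ∑-alt-even (suc u) = begin
    ∑ (suc (suc (u ℕ.* 2))) alt                          ≈⟨ ∑-snoc₂ (u ℕ.* 2) alt ⟩
    ∑ (u ℕ.* 2) alt + alt (u ℕ.* 2) + alt (suc (u ℕ.* 2)) ≈⟨ +-congʳ (+-congʳ (∑-alt-even u)) ⟩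
    0# + alt (u ℕ.* 2) + - alt (u ℕ.* 2)                 ≈⟨ cancel (alt (u ℕ.* 2)) ⟩
    0#                                                   ∎
    where
    cancel : ∀ a → 0# + a + - a ≈ 0#
    cancel = solve 1 (λ a → con (+ 0) :+ a :- a := con (+ 0)) refl

  ∑-altι-even : ∀ u → ∑ (u ℕ.* 2) altι ≈ - fromℕ u
  ∑-altι-even zero    = sym -0#≈0#
  ∑-altι-even (suc u) = begin
    ∑ (suc (suc (u ℕ.* 2))) altι                          ≈⟨ ∑-snoc₂ (u ℕ.* 2) altι ⟩
    ∑ (u ℕ.* 2) altι + altι (u ℕ.* 2) + altι (suc (u ℕ.* 2))
      ≈⟨ +-cong (+-cong (∑-altι-even u) (*-congʳ (alt-even u))) (*-cong (-‿cong (alt-even u)) (fromℕ-suc (u ℕ.* 2))) ⟩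
    - fromℕ u + 1# * fromℕ (u ℕ.* 2) + - 1# * (1# + fromℕ (u ℕ.* 2))
      ≈⟨ cancel (fromℕ u) (fromℕ (u ℕ.* 2)) ⟩
    - (1# + fromℕ u)                                      ≈⟨ -‿cong (fromℕ-suc u) ⟨
    - fromℕ (suc u)                                       ∎
    where
    cancel : ∀ a b → - a + 1# * b + - 1# * (1# + b) ≈ - (1# + a)
    cancel = solve 2 (λ a b → :- a :+ con (+ 1) :* b :+ con (ℤ.- + 1) :* (con (+ 1) :+ b) := :- (con (+ 1) :+ a)) refl

  rectsMass-linear : ∀ (h α : ℕ → Carrier) P → (∀ m → h m ≈ α m * P) → ∀ rs → rectsMass h rs ≈ rectsMass α rs * P
  rectsMass-linear h α P h≈αP []                      = sym (zeroˡ P)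
  rectsMass-linear h α P h≈αP ((c₁ , k₁ , c₂ , k₂) ∷ rs) =
    trans (+-cong (trans (∑-cong (suc k₁) (λ i → trans (∑-cong (suc k₂) (λ j → h≈αP (idx i j)))
                                                       (∑-*ʳ (suc k₂) P (λ j → α (idx i j)))))
                         (∑-*ʳ (suc k₁) P (λ i → ∑ (suc k₂) (λ j → α (idx i j)))))
                  (rectsMass-linear h α P h≈αP rs))
          (sym (distribʳ P _ _))
    where
    idx : ℕ → ℕ → ℕ
    idx i j = c₁ ℕ.+ c₂ ℕ.+ i ℕ.+ j

  rectsMass-+ : ∀ (h f g : ℕ → Carrier) → (∀ m → h m ≈ f m + g m) → ∀ rs → rectsMass h rs ≈ rectsMass f rs + rectsMass g rs
  rectsMass-+ h f g h≈f+g []                      = sym (+-identityʳ 0#)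
  rectsMass-+ h f g h≈f+g (r@(c₁ , k₁ , c₂ , k₂) ∷ rs) =
    trans (+-cong (trans (∑-cong (suc k₁) (λ i → trans (∑-cong (suc k₂) (λ j → h≈f+g (idx i j)))
                                                       (∑-+ (suc k₂) (λ j → f (idx i j)) (λ j → g (idx i j)))))
                         (∑-+ (suc k₁) (λ i → ∑ (suc k₂) (λ j → f (idx i j))) (λ i → ∑ (suc k₂) (λ j → g (idx i j)))))
                  (rectsMass-+ h f g h≈f+g rs))
          (+-middle-swap (rectMass f r) (rectMass g r) (rectsMass f rs) (rectsMass g rs))
    where
    idx : ℕ → ℕ → ℕ
    idx i j = c₁ ℕ.+ c₂ ℕ.+ i ℕ.+ j

  rectMass-alt : ∀ c₁ k₁ c₂ k₂ →
    rectMass alt (c₁ , k₁ , c₂ , k₂) ≈ alt (c₁ ℕ.+ c₂) * (∑ (suc k₁) alt * ∑ (suc k₂) alt)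
  rectMass-alt c₁ k₁ c₂ k₂ = begin
    ∑ (suc k₁) (λ i → ∑ (suc k₂) (λ j → alt (c₀ ℕ.+ i ℕ.+ j)))
      ≈⟨ ∑-cong (suc k₁) (λ i → ∑-cong (suc k₂) (λ j → trans (alt-+ (c₀ ℕ.+ i) j) (*-congʳ (alt-+ c₀ i)))) ⟩
    ∑ (suc k₁) (λ i → ∑ (suc k₂) (λ j → alt c₀ * alt i * alt j))
      ≈⟨ ∑-cong (suc k₁) (λ i → ∑-*ˡ (suc k₂) (alt c₀ * alt i) alt) ⟩
    ∑ (suc k₁) (λ i → alt c₀ * alt i * ∑ (suc k₂) alt)
      ≈⟨ ∑-*ʳ (suc k₁) (∑ (suc k₂) alt) (λ i → alt c₀ * alt i) ⟩
    ∑ (suc k₁) (λ i → alt c₀ * alt i) * ∑ (suc k₂) alt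
      ≈⟨ trans (*-congʳ (∑-*ˡ (suc k₁) (alt c₀) alt)) (*-assoc _ _ _) ⟩
    alt c₀ * (∑ (suc k₁) alt * ∑ (suc k₂) alt) ∎
    where
    c₀ : ℕ
    c₀ = c₁ ℕ.+ c₂

  rectMass-altι-origin : ∀ k₁ k₂ →
    rectMass altι (0 , k₁ , 0 , k₂) ≈ ∑ (suc k₁) altι * ∑ (suc k₂) alt + ∑ (suc k₁) alt * ∑ (suc k₂) altι
  rectMass-altι-origin k₁ k₂ = begin
    ∑ (suc k₁) (λ i → ∑ (suc k₂) (λ j → altι (i ℕ.+ j)))
      ≈⟨ ∑-cong (suc k₁) (λ i → ∑-cong (suc k₂) (λ j →
           trans (*-cong (alt-+ i j) (fromℕ-+ i j)) (expand (alt i) (alt j) (fromℕ i) (fromℕ j)))) ⟩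
    ∑ (suc k₁) (λ i → ∑ (suc k₂) (λ j → altι i * alt j + alt i * altι j))
      ≈⟨ ∑-cong (suc k₁) (λ i → trans (∑-+ (suc k₂) (λ j → altι i * alt j) (λ j → alt i * altι j))
                                     (+-cong (∑-*ˡ (suc k₂) (altι i) alt) (∑-*ˡ (suc k₂) (alt i) altι))) ⟩
    ∑ (suc k₁) (λ i → altι i * ∑ (suc k₂) alt + alt i * ∑ (suc k₂) altι)
      ≈⟨ trans (∑-+ (suc k₁) (λ i → altι i * ∑ (suc k₂) alt) (λ i → alt i * ∑ (suc k₂) altι))
              (+-cong (∑-*ʳ (suc k₁) (∑ (suc k₂) alt) altι) (∑-*ʳ (suc k₁) (∑ (suc k₂) altι) alt)) ⟩
    ∑ (suc k₁) altι * ∑ (suc k₂) alt + ∑ (suc k₁) alt * ∑ (suc k₂) altι ∎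
    where
    expand : ∀ a b u v → (a * b) * (u + v) ≈ (a * u) * b + a * (b * v)
    expand = solve 4 (λ a b u v → (a :* b) :* (u :+ v) := (a :* u) :* b :+ a :* (b :* v)) refl

  _⟨*⟩_ : ∀ {a b} → a ≈ 1# → b ≈ 1# → a * b ≈ 1#
  a≈1 ⟨*⟩ b≈1 = trans (*-cong a≈1 b≈1) (*-identityˡ 1#)

  cancellingPair : ∀ {R R′ u v X Y} → R ≈ u * X → R′ ≈ v * Y → u ≈ - v → X ≈ 1# → Y ≈ 1# → R + (R′ + 0#) ≈ 0#
  cancellingPair {u = u} {v} R≈uX R′≈vY u≈-v X≈1 Y≈1 = begin
    _ + (_ + 0#)     ≈⟨ +-cong (trans R≈uX (*-cong u≈-v X≈1)) (trans (+-identityʳ _) (trans R′≈vY (*-congˡ Y≈1))) ⟩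
    - v * 1# + v * 1# ≈⟨ trans (+-cong (*-identityʳ _) (*-identityʳ _)) (-‿inverseˡ v) ⟩
    0#               ∎

  shapeMass-alt : ∀ k s → rectsMass alt (shapeRects (suc k ℕ.* 2) s) ≈ 0#
  shapeMass-alt k F.zero =
    cancellingPair (rectMass-alt 0 0 0 (suc k ℕ.* 2)) (rectMass-alt 1 0 0 0) (sym (-‿involutive 1#))
                   (∑-alt-odd 0 ⟨*⟩ ∑-alt-odd (suc k)) (∑-alt-odd 0 ⟨*⟩ ∑-alt-odd 0)
  shapeMass-alt k (F.suc F.zero) =
    cancellingPair (rectMass-alt 1 0 0 (suc k ℕ.* 2)) (rectMass-alt 0 0 (suc k ℕ.* 2) 0) (-‿cong (sym (alt-even (suc k))))
                   (∑-alt-odd 0 ⟨*⟩ ∑-alt-odd (suc k)) (∑-alt-odd 0 ⟨*⟩ ∑-alt-odd 0)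
  shapeMass-alt k (F.suc (F.suc F.zero)) =
    cancellingPair (rectMass-alt 0 (suc k ℕ.* 2) 0 0) (rectMass-alt 0 0 1 0) (sym (-‿involutive 1#))
                   (∑-alt-odd (suc k) ⟨*⟩ ∑-alt-odd 0) (∑-alt-odd 0 ⟨*⟩ ∑-alt-odd 0)
  shapeMass-alt k (F.suc (F.suc (F.suc F.zero))) =
    cancellingPair (rectMass-alt 0 (suc k ℕ.* 2) 1 0) (rectMass-alt (suc k ℕ.* 2) 0 0 0)
                   (-‿cong (sym (trans (≡⇒≈ (≡.cong alt (ℕP.+-identityʳ (suc k ℕ.* 2)))) (alt-even (suc k)))))
                   (∑-alt-odd (suc k) ⟨*⟩ ∑-alt-odd 0) (∑-alt-odd 0 ⟨*⟩ ∑-alt-odd 0)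
  shapeMass-alt k (F.suc (F.suc (F.suc (F.suc F.zero)))) = begin
    rectMass alt (0 , 1 , 0 , 1) + 0#                 ≈⟨ +-identityʳ _ ⟩
    rectMass alt (0 , 1 , 0 , 1)                      ≈⟨ rectMass-alt 0 1 0 1 ⟩
    alt 0 * (∑ 2 alt * ∑ 2 alt)                       ≈⟨ *-congˡ (*-congʳ ∑₂≈0) ⟩
    alt 0 * (0# * ∑ 2 alt)                            ≈⟨ trans (*-congˡ (zeroˡ _)) (zeroʳ _) ⟩
    0#                                                ∎
    where
    ∑₂≈0 : ∑ 2 alt ≈ 0#
    ∑₂≈0 = trans (+-congˡ (+-identityʳ _)) (-‿inverseʳ 1#)

  -- Syntactic copies of ∑ and rectsMass: the ring solver evaluates closed masses through them.
  ∑ᵖ : ℕ → (ℕ → Polynomial 0) → Polynomial 0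
  ∑ᵖ zero    f = con (+ 0)
  ∑ᵖ (suc L) f = f 0 :+ ∑ᵖ L (λ t → f (suc t))

  rectsMassᵖ : (ℕ → Polynomial 0) → List Rect → Polynomial 0
  rectsMassᵖ h []                      = con (+ 0)
  rectsMassᵖ h ((c₁ , k₁ , c₂ , k₂) ∷ rs) =
    ∑ᵖ (suc k₁) (λ i → ∑ᵖ (suc k₂) (λ j → h (c₁ ℕ.+ c₂ ℕ.+ i ℕ.+ j))) :+ rectsMassᵖ h rs

  altιᵖ : ℕ → Polynomial 0
  altιᵖ m = sign m :* con (+ m)
    where
    sign : ℕ → Polynomial 0
    sign zero    = con (+ 1)
    sign (suc m) = :- sign m

  shapeMass-altι : ∀ s → rectsMass altι (shapeRects 2 s) ≈ 0#
  shapeMass-altι s@F.zero                                 = solve 0 (rectsMassᵖ altιᵖ (shapeRects 2 s) := con (+ 0)) refl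
  shapeMass-altι s@(F.suc F.zero)                         = solve 0 (rectsMassᵖ altιᵖ (shapeRects 2 s) := con (+ 0)) refl
  shapeMass-altι s@(F.suc (F.suc F.zero))                 = solve 0 (rectsMassᵖ altιᵖ (shapeRects 2 s) := con (+ 0)) refl
  shapeMass-altι s@(F.suc (F.suc (F.suc F.zero)))         = solve 0 (rectsMassᵖ altιᵖ (shapeRects 2 s) := con (+ 0)) refl
  shapeMass-altι s@(F.suc (F.suc (F.suc (F.suc F.zero)))) = solve 0 (rectsMassᵖ altιᵖ (shapeRects 2 s) := con (+ 0)) refl

  σι : ℤ → Carrier
  σι z = σ z * fromℤ z

  ZeroMassOnTiles-σ : ∀ k → ZeroMassOnTiles (suc (suc (suc k ℕ.* 2))) σ
  ZeroMassOnTiles-σ k s T =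
    trans (rectsMass-linear (λ m → σ (T ℤ.+ + m)) alt (σ T) (σ-shift T) (shapeRects (suc k ℕ.* 2) s))
          (trans (*-congʳ (shapeMass-alt k s)) (zeroˡ _))

  σι-shift : ∀ T m → σι (T ℤ.+ + m) ≈ alt m * (σ T * fromℤ T) + altι m * σ T
  σι-shift T m = trans (*-cong (σ-shift T m) (fromℤ-+ T (+ m))) (expand (alt m) (σ T) (fromℤ T) (fromℕ m))
    where
    expand : ∀ a s i v → (a * s) * (i + v) ≈ a * (s * i) + (a * v) * s
    expand = solve 4 (λ a s i v → (a :* s) :* (i :+ v) := a :* (s :* i) :+ (a :* v) :* s) refl

  ZeroMassOnTiles-σι : ZeroMassOnTiles 4 σι
  ZeroMassOnTiles-σι s T = begin
    rectsMass (λ m → σι (T ℤ.+ + m)) rs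
      ≈⟨ rectsMass-+ _ (λ m → alt m * (σ T * fromℤ T)) (λ m → altι m * σ T) (σι-shift T) rs ⟩
    rectsMass (λ m → alt m * (σ T * fromℤ T)) rs + rectsMass (λ m → altι m * σ T) rs
      ≈⟨ +-cong (rectsMass-linear _ alt (σ T * fromℤ T) (λ m → refl) rs) (rectsMass-linear _ altι (σ T) (λ m → refl) rs) ⟩
    rectsMass alt rs * (σ T * fromℤ T) + rectsMass altι rs * σ T
      ≈⟨ +-cong (*-congʳ (shapeMass-alt 0 s)) (*-congʳ (shapeMass-altι s)) ⟩
    0# * (σ T * fromℤ T) + 0# * σ T
      ≈⟨ trans (+-cong (zeroˡ _) (zeroˡ _)) (+-identityˡ 0#) ⟩
    0# ∎
    where
    rs : List Rect
    rs = shapeRects 2 s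

  ¬SignedTileable-odd-odd : ∀ k u v → ¬ SignedTileable K (suc (suc (suc k ℕ.* 2))) (suc (u ℕ.* 2)) (suc (v ℕ.* 2))
  ¬SignedTileable-odd-odd k u v tiling = nontrivial (begin
    1#                                                   ≈⟨ trans (*-identityˡ _) (∑-alt-odd u ⟨*⟩ ∑-alt-odd v) ⟨
    alt 0 * (∑ (suc (u ℕ.* 2)) alt * ∑ (suc (v ℕ.* 2)) alt) ≈⟨ rectMass-alt 0 (u ℕ.* 2) 0 (v ℕ.* 2) ⟨
    rectMass alt (0 , u ℕ.* 2 , 0 , v ℕ.* 2)              ≈⟨ rectangleMass≈0 _ σ (s≤s z≤n) (ZeroMassOnTiles-σ k) _ _ tiling ⟩
    0#                                                   ∎)

  ¬SignedTileable₄-even-odd : ∀ u v → ¬ SignedTileable K 4 (suc u ℕ.* 2) (suc (v ℕ.* 2))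
  ¬SignedTileable₄-even-odd u v tiling = fromℕ-suc≉0 u (-‿injective (begin
    - fromℕ (suc u)                                       ≈⟨ trans (+-identityʳ _) (*-identityʳ _) ⟨
    - fromℕ (suc u) * 1# + 0#                             ≈⟨ +-congˡ (zeroˡ (∑ (suc (v ℕ.* 2)) altι)) ⟨
    - fromℕ (suc u) * 1# + 0# * ∑ (suc (v ℕ.* 2)) altι
      ≈⟨ +-cong (*-cong (∑-altι-even (suc u)) (∑-alt-odd v)) (*-congʳ (∑-alt-even (suc u))) ⟨
    ∑ (suc u ℕ.* 2) altι * ∑ (suc (v ℕ.* 2)) alt + ∑ (suc u ℕ.* 2) alt * ∑ (suc (v ℕ.* 2)) altι
      ≈⟨ rectMass-altι-origin (suc (u ℕ.* 2)) (v ℕ.* 2) ⟨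
    rectMass altι (0 , suc (u ℕ.* 2) , 0 , v ℕ.* 2)         ≈⟨ rectangleMass≈0 4 σι (s≤s z≤n) ZeroMassOnTiles-σι _ _ tiling ⟩
    0#                                                     ≈⟨ -0#≈0# ⟨
    - 0#                                                   ∎))

  parity : ∀ m → (Σ ℕ λ u → m ≡ u ℕ.* 2) ⊎ (Σ ℕ λ u → m ≡ suc (u ℕ.* 2))
  parity zero = inj₁ (0 , ≡.refl)
  parity (suc m) with parity m
  ... | inj₁ (u , ≡.refl) = inj₂ (u , ≡.refl)
  ... | inj₂ (u , ≡.refl) = inj₁ (suc u , ≡.refl)

  2∣even : ∀ u → 2 ∣ suc u ℕ.* 2
  2∣even u = divides (suc u) ≡.refl

  2∤odd : ∀ u → ¬ 2 ∣ suc (u ℕ.* 2)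
  2∤odd u (divides m odd≡) = ℕP.even≢odd m u (≡.trans (ℕP.*-comm 2 m) (≡.trans (≡.sym odd≡) (≡.cong suc (ℕP.*-comm u 2))))

  SignedTileable⇔evenSide : ∀ t p q →
    SignedTileable K (suc (suc (suc (suc t) ℕ.* 2))) (suc p) (suc q) ⇔ (2 ∣ suc p ⊎ 2 ∣ suc q)
  SignedTileable⇔evenSide t p q with parity p | parity q
  ... | inj₂ (u , ≡.refl) | _                 =
    mk⇔ (λ _ → inj₁ (2∣even u)) (λ _ → SignedTileable-even-side t u q)
  ... | inj₁ (u , ≡.refl) | inj₂ (v , ≡.refl) =
    mk⇔ (λ _ → inj₂ (2∣even v))
        (λ _ → SignedTileable-transpose (suc v ℕ.* 2) (suc (u ℕ.* 2)) (SignedTileable-even-side t v (u ℕ.* 2)))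
  ... | inj₁ (u , ≡.refl) | inj₁ (v , ≡.refl) =
    mk⇔ (⊥-elim ∘ ¬SignedTileable-odd-odd (suc t) u v) (⊥-elim ∘ [ 2∤odd u , 2∤odd v ])

  SignedTileable₄⇔evenSides : ∀ p q → SignedTileable K 4 (suc p) (suc q) ⇔ (2 ∣ suc p × 2 ∣ suc q)
  SignedTileable₄⇔evenSides p q with parity p | parity q
  ... | inj₂ (u , ≡.refl) | inj₂ (v , ≡.refl) =
    mk⇔ (λ _ → 2∣even u , 2∣even v) (λ _ → SignedTileable-even-even u v)
  ... | inj₂ (u , ≡.refl) | inj₁ (v , ≡.refl) =
    mk⇔ (⊥-elim ∘ ¬SignedTileable₄-even-odd u v) (⊥-elim ∘ 2∤odd v ∘ proj₂)
  ... | inj₁ (u , ≡.refl) | inj₂ (v , ≡.refl) =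
    mk⇔ (⊥-elim ∘ ¬SignedTileable₄-even-odd v u ∘ SignedTileable-transpose (suc (u ℕ.* 2)) (suc v ℕ.* 2))
        (⊥-elim ∘ 2∤odd u ∘ proj₁)
  ... | inj₁ (u , ≡.refl) | inj₁ (v , ≡.refl) =
    mk⇔ (⊥-elim ∘ ¬SignedTileable-odd-odd 0 u v) (⊥-elim ∘ 2∤odd u ∘ proj₁)

theorem4 : ∀ {c ℓ : Level} (K : ACF0 c ℓ) →
    (∀ (n p q : ℕ) → 2 ∣ n → 6 ≤ n → 1 ≤ p → 1 ≤ q →
       (SignedTileable K n p q ⇔ (2 ∣ p ⊎ 2 ∣ q)))
    ×
    (∀ (p q : ℕ) → 1 ≤ p → 1 ≤ q →
       (SignedTileable K 4 p q ⇔ (2 ∣ p × 2 ∣ q)))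
theorem4 K = n≥6 , n≡4
  where
  n≥6 : ∀ n p q → 2 ∣ n → 6 ≤ n → 1 ≤ p → 1 ≤ q → SignedTileable K n p q ⇔ (2 ∣ p ⊎ 2 ∣ q)
  n≥6 _ (suc p) (suc q) (divides (suc (suc (suc t))) ≡.refl) _ _ _ = SignedTileable⇔evenSide K t p q
  n≥6 _ _ _ (divides 0 ≡.refl) ()
  n≥6 _ _ _ (divides 1 ≡.refl) (s≤s (s≤s ()))
  n≥6 _ _ _ (divides 2 ≡.refl) (s≤s (s≤s (s≤s (s≤s ()))))
  n≡4 : ∀ p q → 1 ≤ p → 1 ≤ q → SignedTileable K 4 p q ⇔ (2 ∣ p × 2 ∣ q)
  n≡4 (suc p) (suc q) _ _ = SignedTileable₄⇔evenSides K p q
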